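{- Let $$A_k(x)=\frac{x^2}{1-x^2F_{k-2}(x)}A_{k-1}(x)+\frac{x^4F_{k-1}(x)}{(1-x^2F_{k-2}(x))^2}A_{k-2}(x)$$ for all $k\geq2$, where $A_1(x)=0$ and $A_2(x)=x^4$. Then for all $k\geq2$ $$\mathcal{D}_{12\dots k;1}(x)=A_k(x)+xA_{k-1}(x).$$
   Context: A permutation $\pi$ is a Dumont permutation (of the first kind) if each even integer in $\pi$ is followed by a smaller integer, and each odd integer is either followed by a larger integer or is the last element of $\pi$. Let $\mathcal{D}_{\tau;r}(n)$ be the number of Dumont permutations of length $n$ that avoid $132$ and contain the pattern $\tau$ exactly $r$ times, and $\mathcal{D}_{\tau;r}(x)=\sum_{n\geq0}\mathcal{D}_{\tau;r}(n)x^n$. For $r\geq2$ consider $Q_r(x)=1+\frac{x^2Q_{r-1}(x)}{1-x^2Q_{r-2}(x)}$; $F_r(x)$ is its solution with $Q_0(x)=0$, $Q_1(x)=1$. -}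

module Defs where

open import Data.Nat using (ℕ; zero; suc; _+_; _*_; _∸_; _<ᵇ_; _≡ᵇ_)
open import Data.Bool using (Bool; true; false; _∧_; _∨_; not; if_then_else_)
open import Data.List using (List; []; _∷_; map; length; upTo; _++_)

-- Formal power series with natural-number coefficients
-- (all series in the statement have nonnegative coefficients and are
-- built from +, ·, and 1/(1-g) with g(0)=0).

Series : Set
Series = ℕ → ℕ

sumTo : ℕ → (ℕ → ℕ) → ℕ
sumTo zero    f = f 0
sumTo (suc n) f = sumTo n f + f (suc n)

𝟘 : Series
𝟘 _ = 0

𝟙 : Series
𝟙 zero    = 1
𝟙 (suc _) = 0

X : Series
X 1 = 1
X _ = 0

infixl 6 _⊕_
infixl 7 _⊛_

_⊕_ : Series → Series → Series
(f ⊕ g) n = f n + g n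

_⊛_ : Series → Series → Series
(f ⊛ g) n = sumTo n (λ i → f i * g (n ∸ i))

pow : Series → ℕ → Series
pow g zero    = 𝟙
pow g (suc j) = g ⊛ pow g j

xpow : ℕ → Series
xpow m = pow X m

-- geom g = 1/(1-g) = Σ_j g^j, valid (as the inverse of 1-g) when g(0)=0;
-- then g^j contributes only to coefficients of index ≥ j, so the n-th
-- coefficient only needs j ≤ n.
geom : Series → Series
geom g n = sumTo n (λ j → pow g j n)

F : ℕ → Series
F zero = 𝟘
F (suc zero) = 𝟙
F (suc (suc r)) = 𝟙 ⊕ (xpow 2 ⊛ F (suc r)) ⊛ geom (xpow 2 ⊛ F r)

A : ℕ → Series
A zero = 𝟘
A (suc zero) = 𝟘
A (suc (suc zero)) = xpow 4
A (suc (suc (suc m))) =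
  xpow 2 ⊛ geom (xpow 2 ⊛ F (suc m)) ⊛ A (suc (suc m))
  ⊕ xpow 4 ⊛ F (suc (suc m)) ⊛ geom (xpow 2 ⊛ F (suc m))
      ⊛ geom (xpow 2 ⊛ F (suc m)) ⊛ A (suc m)

countᵇ : {A : Set} → (A → Bool) → List A → ℕ
countᵇ p [] = 0
countᵇ p (a ∷ as) = if p a then suc (countᵇ p as) else countᵇ p as

allᵇ : {A : Set} → (A → Bool) → List A → Bool
allᵇ p [] = true
allᵇ p (a ∷ as) = p a ∧ allᵇ p as

words : List ℕ → ℕ → List (List ℕ)
words al zero = [] ∷ []
words al (suc m) = concatMap′ (words al m)
  where
  concatMap′ : List (List ℕ) → List (List ℕ)
  concatMap′ [] = []
  concatMap′ (w ∷ ws) = map (λ a → a ∷ w) al ++ concatMap′ ws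

range : ℕ → List ℕ
range n = map suc (upTo n)

distinctᵇ : List ℕ → Bool
distinctᵇ [] = true
distinctᵇ (a ∷ as) = allᵇ (λ b → not (a ≡ᵇ b)) as ∧ distinctᵇ as

perms : ℕ → List (List ℕ)
perms n = filter′ (words (range n) n)
  where
  filter′ : List (List ℕ) → List (List ℕ)
  filter′ [] = []
  filter′ (w ∷ ws) = if distinctᵇ w then w ∷ filter′ ws else filter′ ws

choose : ℕ → List ℕ → List (List ℕ)
choose zero _ = [] ∷ []
choose (suc m) [] = []
choose (suc m) (a ∷ as) = map (a ∷_) (choose m as) ++ choose (suc m) as

orderIsoᵇ : List ℕ → List ℕ → Bool
orderIsoᵇ [] [] = true
orderIsoᵇ (a ∷ as) (t ∷ ts) = compat as ts ∧ orderIsoᵇ as ts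
  where
  eqB : Bool → Bool → Bool
  eqB true true = true
  eqB false false = true
  eqB _ _ = false
  compat : List ℕ → List ℕ → Bool
  compat [] [] = true
  compat (b ∷ bs) (u ∷ us) =
    eqB (a <ᵇ b) (t <ᵇ u) ∧ eqB (b <ᵇ a) (u <ᵇ t) ∧ compat bs us
  compat _ _ = false
orderIsoᵇ _ _ = false

occ : List ℕ → List ℕ → ℕ
occ τ π = countᵇ (orderIsoᵇ τ) (choose (length τ) π)

evenᵇ : ℕ → Bool
evenᵇ zero = true
evenᵇ (suc n) = not (evenᵇ n)


dumontᵇ : List ℕ → Bool
dumontᵇ [] = true
dumontᵇ (a ∷ []) = not (evenᵇ a)
dumontᵇ (a ∷ b ∷ rest) =
  (if evenᵇ a then b <ᵇ a else a <ᵇ b) ∧ dumontᵇ (b ∷ rest)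

pat132 : List ℕ
pat132 = 1 ∷ 3 ∷ 2 ∷ []

D : List ℕ → ℕ → ℕ → ℕ
D τ r n = countᵇ (λ π → dumontᵇ π ∧ (occ pat132 π ≡ᵇ 0) ∧ (occ τ π ≡ᵇ r))
                 (perms n)

incPat : ℕ → List ℕ
incPat k = range k

{-# OPTIONS --safe #-}
-- Split a 132-avoiding Dumont permutation at its maximum n.  Avoiding 132
-- puts every entry left of n above every entry right of n, and the Dumont
-- condition then leaves three forms: σ (2m+1) for length 2m+1 (form O);
-- (2m+2) τ (2m+1) and σ′ (2m+1) (2m+2) ρ for length 2m+2 (forms A and B),
-- where σ′ is σ shifted by |ρ|, which must be even because the smallest
-- entry of an odd shift would be an even entry with nothing smaller after it.
-- The number of occurrences of 12…k is additive along these forms, so the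
-- generating functions, in y = x² and by half-length, of the permutations
-- avoiding 12…k, and of those containing it exactly once, satisfy linear
-- equations h = f + y g h.  Their unique solutions h = f / (1 - y g) obey the
-- recurrences of F_k and A_k in y; substituting y = x² and adding the odd
-- lengths, which contribute x A_{k-1}, gives the theorem.
module Submission where

open import Defs
open import Data.Nat
open import Data.Nat.Properties
open import Data.Nat.ListAction using (sum)
open import Algebra.Properties.CommutativeSemigroup +-commutativeSemigroup
  using () renaming (interchange to +-interchange)
open import Data.Bool using (Bool; true; false; _∧_; _∨_; not; if_then_else_; T?)
open import Data.Bool.Properties
  using (T-≡; ∧-conicalˡ; ∧-conicalʳ; ∧-assoc; ∧-zeroʳ; ∨-identityʳ; not-involutive)
open import Data.Empty using (⊥-elim)
open import Data.List
  using (List; []; _∷_; [_]; _++_; map; length; applyUpTo; filter; filterᵇ; cartesianProductWith)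
open import Data.List.Membership.DecPropositional _≟_ using (_∈?_)
open import Data.List.Membership.Propositional using (_∈_; _∉_)
open import Data.List.Membership.Propositional.Properties
  using (∈-map⁺; ∈-map⁻; ∈-++⁺ˡ; ∈-++⁺ʳ; ∈-++⁻; ∈-upTo⁺; ∈-upTo⁻; ∈-applyUpTo⁻; ∈-∃++;
         ∈-filter⁺; ∈-filter⁻; ∈-cartesianProductWith⁺; ∈-cartesianProductWith⁻)
open import Data.List.Membership.Propositional.Properties.WithK using (unique∧set⇒bag)
open import Data.List.Properties
  using (∷-injective; ∷-injectiveˡ; ∷-injectiveʳ; ∷ʳ-injectiveˡ; ++-assoc; length-++; length-map;
         map-++; map-cong-local; map-upTo; length-applyUpTo; filter-all; filter-accept; filter-reject)
open import Data.List.Relation.Binary.BagAndSetEquality using (∼bag⇒↭)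
open import Data.List.Relation.Binary.Permutation.Propositional
  using (_↭_; prep; swap) renaming (refl to ↭-refl; trans to ↭-trans)
open import Data.List.Relation.Unary.All using (All; []; _∷_)
import Data.List.Relation.Unary.All as All
open import Data.List.Relation.Unary.All.Properties
  using (All¬⇒¬Any; ++⁺; ++⁻ˡ; ++⁻ʳ) renaming (map⁺ to All-map⁺)
open import Data.List.Relation.Unary.AllPairs using ([]; _∷_)
open import Data.List.Relation.Unary.Any using (here; there)
open import Data.List.Relation.Unary.Unique.Propositional using (Unique)
import Data.List.Relation.Unary.Unique.Propositional.Properties as Unique
open import Data.Product using (_×_; _,_; proj₁; proj₂; ∃-syntax) renaming (swap to ×-swap)
open import Data.Sum using (_⊎_; inj₁; inj₂)
open import Data.Unit using (⊤; tt)
open import Function using (_∘_; flip)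
open import Function.Bundles using (module Equivalence; mk⇔)
open import Relation.Binary.Bundles using (Setoid)
open import Relation.Binary.Definitions using (tri<; tri≈; tri>)
open import Relation.Binary.PropositionalEquality hiding ([_])
import Relation.Binary.Reasoning.Setoid as SetoidReasoning
open import Relation.Nullary using (¬_; ¬?; contradiction; yes; no)

open Setoid (ℕ →-setoid ℕ) using () renaming (sym to ≗-sym; trans to ≗-trans)
module ≗-Reasoning = SetoidReasoning (ℕ →-setoid ℕ)

private variable
  A₁ B₁ C₁ : Set

-- Finite sums

sumTo-cong : ∀ n {f g : ℕ → ℕ} → (∀ i → i ≤ n → f i ≡ g i) → sumTo n f ≡ sumTo n g
sumTo-cong zero    f≡g = f≡g 0 z≤n
sumTo-cong (suc n) f≡g =
  cong₂ _+_ (sumTo-cong n (λ i i≤n → f≡g i (m≤n⇒m≤1+n i≤n))) (f≡g (suc n) ≤-refl)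

sumTo-ext : ∀ n {f g : ℕ → ℕ} → f ≗ g → sumTo n f ≡ sumTo n g
sumTo-ext n f≗g = sumTo-cong n (λ i _ → f≗g i)

sumTo-zero : ∀ n (f : ℕ → ℕ) → (∀ i → i ≤ n → f i ≡ 0) → sumTo n f ≡ 0
sumTo-zero zero    f f≡0 = f≡0 0 z≤n
sumTo-zero (suc n) f f≡0 =
  cong₂ _+_ (sumTo-zero n f (λ i i≤n → f≡0 i (m≤n⇒m≤1+n i≤n))) (f≡0 (suc n) ≤-refl)

sumTo-+ : ∀ n (f g : ℕ → ℕ) → sumTo n (λ i → f i + g i) ≡ sumTo n f + sumTo n g
sumTo-+ zero    f g = refl
sumTo-+ (suc n) f g = trans (cong (_+ (f (suc n) + g (suc n))) (sumTo-+ n f g))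
                            (+-interchange (sumTo n f) (sumTo n g) (f (suc n)) (g (suc n)))

sumTo-*ˡ : ∀ n c (f : ℕ → ℕ) → sumTo n (λ i → c * f i) ≡ c * sumTo n f
sumTo-*ˡ zero    c f = refl
sumTo-*ˡ (suc n) c f = trans (cong (_+ c * f (suc n)) (sumTo-*ˡ n c f))
                             (sym (*-distribˡ-+ c (sumTo n f) (f (suc n))))

sumTo-*ʳ : ∀ n c (f : ℕ → ℕ) → sumTo n (λ i → f i * c) ≡ sumTo n f * c
sumTo-*ʳ n c f = trans (sumTo-ext n (λ i → *-comm (f i) c))
                       (trans (sumTo-*ˡ n c f) (*-comm c (sumTo n f)))

sumTo-suc : ∀ n (f : ℕ → ℕ) → sumTo (suc n) f ≡ f 0 + sumTo n (f ∘ suc)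
sumTo-suc zero    f = refl
sumTo-suc (suc n) f = trans (cong (_+ f (suc (suc n))) (sumTo-suc n f)) (+-assoc (f 0) _ _)

sumTo-reverse : ∀ n (f : ℕ → ℕ) → sumTo n (λ i → f (n ∸ i)) ≡ sumTo n f
sumTo-reverse zero    f = refl
sumTo-reverse (suc n) f = begin
  sumTo n (λ i → f (suc n ∸ i)) + f (n ∸ n)
    ≡⟨ cong₂ _+_ (sumTo-cong n (λ i i≤n → cong f (+-∸-assoc 1 i≤n))) (cong f (n∸n≡0 n)) ⟩
  sumTo n (λ i → f (suc (n ∸ i))) + f 0
    ≡⟨ cong (_+ f 0) (sumTo-reverse n (f ∘ suc)) ⟩
  sumTo n (f ∘ suc) + f 0
    ≡⟨ +-comm _ (f 0) ⟩
  f 0 + sumTo n (f ∘ suc)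
    ≡⟨ sym (sumTo-suc n f) ⟩
  sumTo (suc n) f ∎
  where open ≡-Reasoning

sumTo-swap : ∀ n m (a : ℕ → ℕ → ℕ) →
  sumTo n (λ i → sumTo m (a i)) ≡ sumTo m (λ j → sumTo n (λ i → a i j))
sumTo-swap zero    m a = refl
sumTo-swap (suc n) m a = trans (cong (_+ sumTo m (a (suc n))) (sumTo-swap n m a))
                               (sym (sumTo-+ m (λ j → sumTo n (λ i → a i j)) (a (suc n))))

sumTo-triangle : ∀ n (a : ℕ → ℕ → ℕ) →
  sumTo n (λ i → sumTo i (a i)) ≡ sumTo n (λ j → sumTo (n ∸ j) (λ l → a (j + l) j))
sumTo-triangle zero    a = refl
sumTo-triangle (suc n) a = begin
  sumTo n (λ i → sumTo i (a i)) + (sumTo n (a (suc n)) + a (suc n) (suc n))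
    ≡⟨ cong (_+ (sumTo n (a (suc n)) + a (suc n) (suc n))) (sumTo-triangle n a) ⟩
  Tri n + (sumTo n (a (suc n)) + a (suc n) (suc n))
    ≡⟨ sym (+-assoc (Tri n) _ _) ⟩
  (Tri n + sumTo n (a (suc n))) + a (suc n) (suc n)
    ≡⟨ cong₂ _+_ (sym (sumTo-+ n _ _)) (cong (λ z → a z (suc n)) (sym (+-identityʳ (suc n)))) ⟩
  sumTo n (λ j → sumTo (n ∸ j) (λ l → a (j + l) j) + a (suc n) j) + a (suc n + 0) (suc n)
    ≡⟨ cong₂ _+_ (sumTo-cong n column) (cong (λ q → sumTo q (λ l → a (suc n + l) (suc n))) (sym (n∸n≡0 n))) ⟩
  Tri (suc n) ∎
  where
  open ≡-Reasoning
  Tri : ℕ → ℕ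
  Tri n′ = sumTo n′ (λ j → sumTo (n′ ∸ j) (λ l → a (j + l) j))
  column : ∀ j → j ≤ n →
    sumTo (n ∸ j) (λ l → a (j + l) j) + a (suc n) j ≡ sumTo (suc n ∸ j) (λ l → a (j + l) j)
  column j j≤n rewrite +-∸-assoc 1 j≤n =
    cong (λ z → sumTo (n ∸ j) (λ l → a (j + l) j) + a z j)
         (sym (trans (+-suc j (n ∸ j)) (cong suc (m+[n∸m]≡n j≤n))))

-- Formal power series

⊕-cong : ∀ {f f′ g g′} → f ≗ f′ → g ≗ g′ → f ⊕ g ≗ f′ ⊕ g′
⊕-cong f≗f′ g≗g′ n = cong₂ _+_ (f≗f′ n) (g≗g′ n)

⊛-cong : ∀ {f f′ g g′} → f ≗ f′ → g ≗ g′ → f ⊛ g ≗ f′ ⊛ g′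
⊛-cong f≗f′ g≗g′ n = sumTo-ext n (λ i → cong₂ _*_ (f≗f′ i) (g≗g′ (n ∸ i)))

⊛-congˡ : ∀ {f f′} g → f ≗ f′ → f ⊛ g ≗ f′ ⊛ g
⊛-congˡ g f≗f′ n = sumTo-ext n (λ i → cong (_* g (n ∸ i)) (f≗f′ i))

⊛-congʳ : ∀ f {g g′} → g ≗ g′ → f ⊛ g ≗ f ⊛ g′
⊛-congʳ f g≗g′ n = sumTo-ext n (λ i → cong (f i *_) (g≗g′ (n ∸ i)))

⊛-comm : ∀ f g → f ⊛ g ≗ g ⊛ f
⊛-comm f g n = begin
  sumTo n (λ i → f i * g (n ∸ i))
    ≡⟨ sym (sumTo-reverse n (λ i → f i * g (n ∸ i))) ⟩
  sumTo n (λ i → f (n ∸ i) * g (n ∸ (n ∸ i)))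
    ≡⟨ sumTo-cong n (λ i i≤n → trans (cong (λ z → f (n ∸ i) * g z) (m∸[m∸n]≡n i≤n))
                                     (*-comm (f (n ∸ i)) (g i))) ⟩
  sumTo n (λ i → g i * f (n ∸ i)) ∎
  where open ≡-Reasoning

⊛-distribˡ : ∀ f g h → f ⊛ (g ⊕ h) ≗ f ⊛ g ⊕ f ⊛ h
⊛-distribˡ f g h n =
  trans (sumTo-ext n (λ i → *-distribˡ-+ (f i) (g (n ∸ i)) (h (n ∸ i)))) (sumTo-+ n _ _)

⊛-distribʳ : ∀ f g h → (g ⊕ h) ⊛ f ≗ g ⊛ f ⊕ h ⊛ f
⊛-distribʳ f g h = begin
  (g ⊕ h) ⊛ f    ≈⟨ ⊛-comm (g ⊕ h) f ⟩
  f ⊛ (g ⊕ h)    ≈⟨ ⊛-distribˡ f g h ⟩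
  f ⊛ g ⊕ f ⊛ h  ≈⟨ ⊕-cong (⊛-comm f g) (⊛-comm f h) ⟩
  g ⊛ f ⊕ h ⊛ f  ∎
  where open ≗-Reasoning

⊛-assoc : ∀ f g h → (f ⊛ g) ⊛ h ≗ f ⊛ (g ⊛ h)
⊛-assoc f g h n = begin
  sumTo n (λ i → sumTo i (λ j → f j * g (i ∸ j)) * h (n ∸ i))
    ≡⟨ sym (sumTo-ext n (λ i → sumTo-*ʳ i (h (n ∸ i)) (λ j → f j * g (i ∸ j)))) ⟩
  sumTo n (λ i → sumTo i (λ j → f j * g (i ∸ j) * h (n ∸ i)))
    ≡⟨ sumTo-triangle n (λ i j → f j * g (i ∸ j) * h (n ∸ i)) ⟩
  sumTo n (λ j → sumTo (n ∸ j) (λ l → f j * g (j + l ∸ j) * h (n ∸ (j + l))))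
    ≡⟨ sumTo-ext n (λ j → sumTo-ext (n ∸ j) (λ l →
         trans (cong₂ (λ u v → f j * g u * h v) (m+n∸m≡n j l) (sym (∸-+-assoc n j l)))
               (*-assoc (f j) (g l) (h (n ∸ j ∸ l))))) ⟩
  sumTo n (λ j → sumTo (n ∸ j) (λ l → f j * (g l * h (n ∸ j ∸ l))))
    ≡⟨ sumTo-ext n (λ j → sumTo-*ˡ (n ∸ j) (f j) (λ l → g l * h (n ∸ j ∸ l))) ⟩
  sumTo n (λ j → f j * sumTo (n ∸ j) (λ l → g l * h (n ∸ j ∸ l))) ∎
  where open ≡-Reasoning

⊛-leftComm : ∀ f g h → f ⊛ (g ⊛ h) ≗ g ⊛ (f ⊛ h)
⊛-leftComm f g h = begin
  f ⊛ (g ⊛ h)  ≈⟨ ≗-sym (⊛-assoc f g h) ⟩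
  (f ⊛ g) ⊛ h  ≈⟨ ⊛-congˡ h (⊛-comm f g) ⟩
  (g ⊛ f) ⊛ h  ≈⟨ ⊛-assoc g f h ⟩
  g ⊛ (f ⊛ h)  ∎
  where open ≗-Reasoning

⊛-identityˡ : ∀ f → 𝟙 ⊛ f ≗ f
⊛-identityˡ f zero    = +-identityʳ (f 0)
⊛-identityˡ f (suc n) =
  trans (sumTo-suc n (λ i → 𝟙 i * f (suc n ∸ i)))
        (trans (cong₂ _+_ (+-identityʳ (f (suc n))) (sumTo-zero n _ (λ _ _ → refl)))
               (+-identityʳ (f (suc n))))

⊛-identityʳ : ∀ f → f ⊛ 𝟙 ≗ f
⊛-identityʳ f = ≗-trans (⊛-comm f 𝟙) (⊛-identityˡ f)

⊛-zeroˡ : ∀ f → 𝟘 ⊛ f ≗ 𝟘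
⊛-zeroˡ f n = sumTo-zero n _ (λ _ _ → refl)

⊛-zeroʳ : ∀ f → f ⊛ 𝟘 ≗ 𝟘
⊛-zeroʳ f = ≗-trans (⊛-comm f 𝟘) (⊛-zeroˡ f)

X⊛-suc : ∀ f n → (X ⊛ f) (suc n) ≡ f n
X⊛-suc f n = trans (sumTo-suc n (λ i → X i * f (suc n ∸ i))) (shifted n)
  where
  shifted : ∀ n → 0 + sumTo n (λ i → X (suc i) * f (suc n ∸ suc i)) ≡ f n
  shifted zero    = +-identityʳ (f 0)
  shifted (suc n) =
    trans (sumTo-suc n (λ i → X (suc i) * f (suc (suc n) ∸ suc i)))
          (trans (cong₂ _+_ (+-identityʳ (f (suc n))) (sumTo-zero n _ (λ _ _ → refl)))
                 (+-identityʳ (f (suc n))))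

X⊛⊛-suc : ∀ g h m → ((X ⊛ g) ⊛ h) (suc m) ≡ (g ⊛ h) m
X⊛⊛-suc g h m = trans (⊛-assoc X g h (suc m)) (X⊛-suc (g ⊛ h) m)

pow-cong : ∀ {g g′} → g ≗ g′ → ∀ j → pow g j ≗ pow g′ j
pow-cong g≗g′ zero    n = refl
pow-cong g≗g′ (suc j)   = ⊛-cong g≗g′ (pow-cong g≗g′ j)

pow-+ : ∀ g a b → pow g (a + b) ≗ pow g a ⊛ pow g b
pow-+ g zero    b = ≗-sym (⊛-identityˡ (pow g b))
pow-+ g (suc a) b = ≗-trans (⊛-congʳ g (pow-+ g a b)) (≗-sym (⊛-assoc g (pow g a) (pow g b)))

pow-vanish : ∀ g → g 0 ≡ 0 → ∀ j n → n < j → pow g j n ≡ 0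
pow-vanish g g0≡0 (suc j) n (s≤s n≤j) = sumTo-zero n _ term
  where
  term : ∀ i → i ≤ n → g i * pow g j (n ∸ i) ≡ 0
  term zero    _   rewrite g0≡0 = refl
  term (suc i) i≤n =
    trans (cong (g (suc i) *_) (pow-vanish g g0≡0 j (n ∸ suc i)
                                  (<-≤-trans (∸-monoʳ-< {n} {suc i} {0} (s≤s z≤n) i≤n) n≤j)))
          (*-zeroʳ (g (suc i)))

geom-cong : ∀ {g g′} → g ≗ g′ → geom g ≗ geom g′
geom-cong g≗g′ n = sumTo-ext n (λ j → pow-cong g≗g′ j n)

geomUpTo-stable : ∀ g → g 0 ≡ 0 → ∀ N n → n ≤ N →
  sumTo N (λ j → pow g j n) ≡ sumTo n (λ j → pow g j n)
geomUpTo-stable g g0≡0 N n n≤N =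
  trans (cong (λ z → sumTo z (λ j → pow g j n)) (sym (m∸n+n≡m n≤N))) (stable (N ∸ n))
  where
  stable : ∀ d → sumTo (d + n) (λ j → pow g j n) ≡ sumTo n (λ j → pow g j n)
  stable zero    = refl
  stable (suc d) =
    trans (cong (sumTo (d + n) (λ j → pow g j n) +_) (pow-vanish g g0≡0 (suc (d + n)) n (s≤s (m≤n+m n d))))
          (trans (+-identityʳ _) (stable d))

geom-unfold : ∀ g → g 0 ≡ 0 → geom g ≗ 𝟙 ⊕ g ⊛ geom g
geom-unfold g g0≡0 zero rewrite g0≡0 = refl
geom-unfold g g0≡0 (suc n) = sym (begin
  0 + (g ⊛ geom g) (suc n)
    ≡⟨ sumTo-cong (suc n) (λ i _ → cong (g i *_)
         (sym (geomUpTo-stable g g0≡0 (suc n) (suc n ∸ i) (m∸n≤m (suc n) i)))) ⟩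
  sumTo (suc n) (λ i → g i * sumTo (suc n) (λ j → pow g j (suc n ∸ i)))
    ≡⟨ sumTo-ext (suc n) (λ i → sym (sumTo-*ˡ (suc n) (g i) (λ j → pow g j (suc n ∸ i)))) ⟩
  sumTo (suc n) (λ i → sumTo (suc n) (λ j → g i * pow g j (suc n ∸ i)))
    ≡⟨ sumTo-swap (suc n) (suc n) (λ i j → g i * pow g j (suc n ∸ i)) ⟩
  sumTo (suc n) (λ j → pow g (suc j) (suc n))
    ≡⟨ cong (sumTo n (λ j → pow g (suc j) (suc n)) +_) (pow-vanish g g0≡0 (suc (suc n)) (suc n) ≤-refl) ⟩
  sumTo n (λ j → pow g (suc j) (suc n)) + 0
    ≡⟨ +-identityʳ _ ⟩
  sumTo n (λ j → pow g (suc j) (suc n))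
    ≡⟨ sym (sumTo-suc n (λ j → pow g j (suc n))) ⟩
  geom g (suc n) ∎)
  where open ≡-Reasoning

geom-𝟘 : ∀ {g} → g ≗ 𝟘 → geom g ≗ 𝟙
geom-𝟘 {g} g≗𝟘 = begin
  geom g               ≈⟨ geom-cong g≗𝟘 ⟩
  geom 𝟘               ≈⟨ geom-unfold 𝟘 refl ⟩
  𝟙 ⊕ 𝟘 ⊛ geom 𝟘      ≈⟨ ⊕-cong {𝟙} (λ _ → refl) (⊛-zeroˡ (geom 𝟘)) ⟩
  𝟙 ⊕ 𝟘                ≈⟨ (λ n → +-identityʳ (𝟙 n)) ⟩
  𝟙                    ∎
  where open ≗-Reasoning

-- The coefficient of x^n in g ⊛ h only involves coefficients of h below n.
fixedPoint-unique : ∀ f g {h₁ h₂} → g 0 ≡ 0 →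
  h₁ ≗ f ⊕ g ⊛ h₁ → h₂ ≗ f ⊕ g ⊛ h₂ → h₁ ≗ h₂
fixedPoint-unique f g {h₁} {h₂} g0≡0 eq₁ eq₂ n = below (suc n) n ≤-refl
  where
  below : ∀ n k → k < n → h₁ k ≡ h₂ k
  below (suc n) k (s≤s k≤n) with m≤n⇒m<n∨m≡n k≤n
  ... | inj₁ k<n  = below n k k<n
  ... | inj₂ refl = trans (eq₁ k) (trans (cong (f k +_) (sumTo-cong k term)) (sym (eq₂ k)))
    where
    term : ∀ i → i ≤ k → g i * h₁ (k ∸ i) ≡ g i * h₂ (k ∸ i)
    term zero    _   rewrite g0≡0 = refl
    term (suc i) i≤k = cong (g (suc i) *_) (below k (k ∸ suc i) (∸-monoʳ-< {k} {suc i} {0} (s≤s z≤n) i≤k))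

fixedPoint≗geom⊛ : ∀ f g {h} → g 0 ≡ 0 → h ≗ f ⊕ g ⊛ h → h ≗ geom g ⊛ f
fixedPoint≗geom⊛ f g g0≡0 eq = fixedPoint-unique f g g0≡0 eq (begin
  geom g ⊛ f                 ≈⟨ ⊛-congˡ f (geom-unfold g g0≡0) ⟩
  (𝟙 ⊕ g ⊛ geom g) ⊛ f       ≈⟨ ⊛-distribʳ f 𝟙 (g ⊛ geom g) ⟩
  𝟙 ⊛ f ⊕ (g ⊛ geom g) ⊛ f   ≈⟨ ⊕-cong (⊛-identityˡ f) (⊛-assoc g (geom g) f) ⟩
  f ⊕ g ⊛ (geom g ⊛ f)       ∎)
  where open ≗-Reasoning
-- Substituting x² for x

double : ℕ → ℕ
double zero    = zero
double (suc m) = suc (suc (double m))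

parityView : ∀ n → (∃[ m ] n ≡ double m) ⊎ (∃[ m ] n ≡ suc (double m))
parityView zero          = inj₁ (0 , refl)
parityView (suc zero)    = inj₂ (0 , refl)
parityView (suc (suc n)) with parityView n
... | inj₁ (m , refl) = inj₁ (suc m , refl)
... | inj₂ (m , refl) = inj₂ (suc m , refl)

double-+ : ∀ a b → double a + double b ≡ double (a + b)
double-+ zero    b = refl
double-+ (suc a) b = cong (suc ∘ suc) (double-+ a b)

double-∸ : ∀ m j → double m ∸ double j ≡ double (m ∸ j)
double-∸ zero    zero    = refl
double-∸ zero    (suc j) = refl
double-∸ (suc m) zero    = refl
double-∸ (suc m) (suc j) = double-∸ m j

suc-double-∸ : ∀ m j → double j ≤ suc (double m) → suc (double m) ∸ double j ≡ suc (double (m ∸ j))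
suc-double-∸ m       zero    _                = refl
suc-double-∸ (suc m) (suc j) (s≤s (s≤s j≤m)) = suc-double-∸ m j j≤m

double-cancel-≤ : ∀ {a b} → double a ≤ double b → a ≤ b
double-cancel-≤ {zero}          _               = z≤n
double-cancel-≤ {suc a} {suc b} (s≤s (s≤s a≤b)) = s≤s (double-cancel-≤ a≤b)

double-injective : ∀ {a b} → double a ≡ double b → a ≡ b
double-injective eq = ≤-antisym (double-cancel-≤ (≤-reflexive eq)) (double-cancel-≤ (≤-reflexive (sym eq)))

infix 8 _[x²]

_[x²] : Series → Series
(f [x²]) zero          = f 0
(f [x²]) (suc zero)    = 0
(f [x²]) (suc (suc n)) = ((f ∘ suc) [x²]) n

[x²]-double : ∀ f m → (f [x²]) (double m) ≡ f m
[x²]-double f zero    = refl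
[x²]-double f (suc m) = [x²]-double (f ∘ suc) m

[x²]-odd : ∀ f m → (f [x²]) (suc (double m)) ≡ 0
[x²]-odd f zero    = refl
[x²]-odd f (suc m) = [x²]-odd (f ∘ suc) m

[x²]-cong : ∀ {f g} → f ≗ g → f [x²] ≗ g [x²]
[x²]-cong f≗g zero          = f≗g 0
[x²]-cong f≗g (suc zero)    = refl
[x²]-cong f≗g (suc (suc n)) = [x²]-cong (f≗g ∘ suc) n

[x²]-⊕ : ∀ f g → (f ⊕ g) [x²] ≗ f [x²] ⊕ g [x²]
[x²]-⊕ f g zero          = refl
[x²]-⊕ f g (suc zero)    = refl
[x²]-⊕ f g (suc (suc n)) = [x²]-⊕ (f ∘ suc) (g ∘ suc) n

𝟘[x²] : 𝟘 [x²] ≗ 𝟘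
𝟘[x²] n with parityView n
... | inj₁ (m , refl) = [x²]-double 𝟘 m
... | inj₂ (m , refl) = [x²]-odd 𝟘 m

𝟙[x²] : 𝟙 [x²] ≗ 𝟙
𝟙[x²] zero          = refl
𝟙[x²] (suc zero)    = refl
𝟙[x²] (suc (suc n)) = 𝟘[x²] n

sumTo-double : ∀ f (h : ℕ → ℕ) m →
  sumTo (double m) (λ i → (f [x²]) i * h i) ≡ sumTo m (λ j → f j * h (double j))
sumTo-double f h zero    = refl
sumTo-double f h (suc m) = begin
  (sumTo (double m) (λ i → (f [x²]) i * h i) + (f [x²]) (suc (double m)) * h (suc (double m)))
    + (f [x²]) (double (suc m)) * h (double (suc m))
    ≡⟨ cong₂ _+_ (cong₂ _+_ (sumTo-double f h m) (cong (_* h (suc (double m))) ([x²]-odd f m)))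
                 (cong (_* h (double (suc m))) ([x²]-double f (suc m))) ⟩
  (sumTo m (λ j → f j * h (double j)) + 0) + f (suc m) * h (double (suc m))
    ≡⟨ cong (_+ f (suc m) * h (double (suc m))) (+-identityʳ _) ⟩
  sumTo m (λ j → f j * h (double j)) + f (suc m) * h (double (suc m)) ∎
  where open ≡-Reasoning

[x²]-⊛ : ∀ f g → (f ⊛ g) [x²] ≗ f [x²] ⊛ g [x²]
[x²]-⊛ f g n with parityView n
... | inj₁ (m , refl) = begin
  ((f ⊛ g) [x²]) (double m)
    ≡⟨ [x²]-double (f ⊛ g) m ⟩
  sumTo m (λ j → f j * g (m ∸ j))
    ≡⟨ sumTo-ext m (λ j → cong (f j *_) (sym (trans (cong (g [x²]) (double-∸ m j)) ([x²]-double g (m ∸ j))))) ⟩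
  sumTo m (λ j → f j * (g [x²]) (double m ∸ double j))
    ≡⟨ sym (sumTo-double f (λ i → (g [x²]) (double m ∸ i)) m) ⟩
  sumTo (double m) (λ i → (f [x²]) i * (g [x²]) (double m ∸ i)) ∎
  where open ≡-Reasoning
... | inj₂ (m , refl) = trans ([x²]-odd (f ⊛ g) m) (sym (sumTo-zero (suc (double m)) _ term))
  where
  term : ∀ i → i ≤ suc (double m) → (f [x²]) i * (g [x²]) (suc (double m) ∸ i) ≡ 0
  term i i≤ with parityView i
  ... | inj₁ (j , refl) = trans (cong ((f [x²]) (double j) *_)
                                      (trans (cong (g [x²]) (suc-double-∸ m j i≤)) ([x²]-odd g (m ∸ j))))
                                (*-zeroʳ ((f [x²]) (double j)))
  ... | inj₂ (j , refl) = cong (_* (g [x²]) (suc (double m) ∸ suc (double j))) ([x²]-odd f j)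

X[x²] : X [x²] ≗ xpow 2
X[x²] zero          = refl
X[x²] (suc zero)    = refl
X[x²] (suc (suc n)) = begin
  ((X ∘ suc) [x²]) n   ≡⟨ [x²]-cong X∘suc≗𝟙 n ⟩
  (𝟙 [x²]) n           ≡⟨ 𝟙[x²] n ⟩
  𝟙 n                  ≡⟨ sym (trans (X⊛-suc (X ⊛ 𝟙) (suc n)) (X⊛-suc 𝟙 n)) ⟩
  xpow 2 (suc (suc n)) ∎
  where
  open ≡-Reasoning
  X∘suc≗𝟙 : X ∘ suc ≗ 𝟙
  X∘suc≗𝟙 zero    = refl
  X∘suc≗𝟙 (suc k) = refl

[x²]-pow : ∀ g j → pow g j [x²] ≗ pow (g [x²]) j
[x²]-pow g zero    = 𝟙[x²]
[x²]-pow g (suc j) = ≗-trans ([x²]-⊛ g (pow g j)) (⊛-congʳ (g [x²]) ([x²]-pow g j))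

[x²]-geom : ∀ g → g 0 ≡ 0 → geom g [x²] ≗ geom (g [x²])
[x²]-geom g g0≡0 = ≗-trans (fixedPoint≗geom⊛ 𝟙 (g [x²]) g0≡0 unfolded) (⊛-identityʳ (geom (g [x²])))
  where
  unfolded : geom g [x²] ≗ 𝟙 ⊕ g [x²] ⊛ geom g [x²]
  unfolded = begin
    geom g [x²]                       ≈⟨ [x²]-cong (geom-unfold g g0≡0) ⟩
    (𝟙 ⊕ g ⊛ geom g) [x²]             ≈⟨ [x²]-⊕ 𝟙 (g ⊛ geom g) ⟩
    𝟙 [x²] ⊕ (g ⊛ geom g) [x²]        ≈⟨ ⊕-cong 𝟙[x²] ([x²]-⊛ g (geom g)) ⟩
    𝟙 ⊕ g [x²] ⊛ geom g [x²]          ∎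
    where open ≗-Reasoning

xpow2≗X[x²] : xpow 2 ≗ X [x²]
xpow2≗X[x²] = ≗-sym X[x²]

xpow4≗X²[x²] : xpow 4 ≗ pow X 2 [x²]
xpow4≗X²[x²] = ≗-sym (begin
  pow X 2 [x²]            ≈⟨ [x²]-pow X 2 ⟩
  pow (X [x²]) 2          ≈⟨ pow-cong X[x²] 2 ⟩
  xpow 2 ⊛ (xpow 2 ⊛ 𝟙)   ≈⟨ ⊛-congʳ (xpow 2) (⊛-identityʳ (xpow 2)) ⟩
  xpow 2 ⊛ xpow 2         ≈⟨ ≗-sym (pow-+ X 2 2) ⟩
  xpow 4                  ∎)
  where open ≗-Reasoning

⊕-[x²] : ∀ {f f′ g g′} → f ≗ f′ [x²] → g ≗ g′ [x²] → f ⊕ g ≗ (f′ ⊕ g′) [x²]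
⊕-[x²] {f′ = f′} {g′ = g′} f≗ g≗ = ≗-trans (⊕-cong f≗ g≗) (≗-sym ([x²]-⊕ f′ g′))

⊛-[x²] : ∀ {f f′ g g′} → f ≗ f′ [x²] → g ≗ g′ [x²] → f ⊛ g ≗ (f′ ⊛ g′) [x²]
⊛-[x²] {f′ = f′} {g′ = g′} f≗ g≗ = ≗-trans (⊛-cong f≗ g≗) (≗-sym ([x²]-⊛ f′ g′))

geom-[x²] : ∀ {g g′} → g′ 0 ≡ 0 → g ≗ g′ [x²] → geom g ≗ geom g′ [x²]
geom-[x²] {g′ = g′} g′0≡0 g≗ = ≗-trans (geom-cong g≗) (≗-sym ([x²]-geom g′ g′0≡0))

Φ : ℕ → Series
Φ zero          = 𝟘
Φ (suc zero)    = 𝟙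
Φ (suc (suc r)) = 𝟙 ⊕ (X ⊛ Φ (suc r)) ⊛ geom (X ⊛ Φ r)

Ψ : ℕ → Series
Ψ zero                = 𝟘
Ψ (suc zero)          = 𝟘
Ψ (suc (suc zero))    = pow X 2
Ψ (suc (suc (suc m))) =
  X ⊛ geom (X ⊛ Φ (suc m)) ⊛ Ψ (suc (suc m))
  ⊕ pow X 2 ⊛ Φ (suc (suc m)) ⊛ geom (X ⊛ Φ (suc m)) ⊛ geom (X ⊛ Φ (suc m)) ⊛ Ψ (suc m)

F≗Φ[x²] : ∀ r → F r ≗ Φ r [x²]
F≗Φ[x²] zero          = ≗-sym 𝟘[x²]
F≗Φ[x²] (suc zero)    = ≗-sym 𝟙[x²]
F≗Φ[x²] (suc (suc r)) =
  ⊕-[x²] (≗-sym 𝟙[x²])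
         (⊛-[x²] (⊛-[x²] xpow2≗X[x²] (F≗Φ[x²] (suc r)))
                 (geom-[x²] refl (⊛-[x²] xpow2≗X[x²] (F≗Φ[x²] r))))

A≗Ψ[x²] : ∀ k → A k ≗ Ψ k [x²]
A≗Ψ[x²] zero                = ≗-sym 𝟘[x²]
A≗Ψ[x²] (suc zero)          = ≗-sym 𝟘[x²]
A≗Ψ[x²] (suc (suc zero))    = xpow4≗X²[x²]
A≗Ψ[x²] (suc (suc (suc m))) =
  ⊕-[x²] (⊛-[x²] (⊛-[x²] xpow2≗X[x²] G) (A≗Ψ[x²] (suc (suc m))))
         (⊛-[x²] (⊛-[x²] (⊛-[x²] (⊛-[x²] xpow4≗X²[x²] (F≗Φ[x²] (suc (suc m)))) G) G) (A≗Ψ[x²] (suc m)))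
  where
  G : geom (xpow 2 ⊛ F (suc m)) ≗ geom (X ⊛ Φ (suc m)) [x²]
  G = geom-[x²] refl (⊛-[x²] xpow2≗X[x²] (F≗Φ[x²] (suc m)))
-- Counting in lists

countᵇ-++ : ∀ (p : A₁ → Bool) xs ys → countᵇ p (xs ++ ys) ≡ countᵇ p xs + countᵇ p ys
countᵇ-++ p []       ys = refl
countᵇ-++ p (x ∷ xs) ys with p x
... | true  = cong suc (countᵇ-++ p xs ys)
... | false = countᵇ-++ p xs ys

countᵇ-map : ∀ (p : B₁ → Bool) (f : A₁ → B₁) xs → countᵇ p (map f xs) ≡ countᵇ (p ∘ f) xs
countᵇ-map p f []       = refl
countᵇ-map p f (x ∷ xs) with p (f x)
... | true  = cong suc (countᵇ-map p f xs)
... | false = countᵇ-map p f xs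

countᵇ-cong : ∀ {p q : A₁ → Bool} xs → (∀ {x} → x ∈ xs → p x ≡ q x) → countᵇ p xs ≡ countᵇ q xs
countᵇ-cong {p = p} {q} []       p≡q = refl
countᵇ-cong {p = p} {q} (x ∷ xs) p≡q with p x | q x | p≡q (here refl)
... | true  | true  | _ = cong suc (countᵇ-cong xs (p≡q ∘ there))
... | false | false | _ = countᵇ-cong xs (p≡q ∘ there)

countᵇ-ext : ∀ {p q : A₁ → Bool} xs → p ≗ q → countᵇ p xs ≡ countᵇ q xs
countᵇ-ext xs p≗q = countᵇ-cong xs (λ {x} _ → p≗q x)

countᵇ-none : ∀ (p : A₁ → Bool) xs → (∀ {x} → x ∈ xs → p x ≡ false) → countᵇ p xs ≡ 0
countᵇ-none p []       none = refl
countᵇ-none p (x ∷ xs) none rewrite none (here refl) = countᵇ-none p xs (none ∘ there)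

countᵇ-pos : ∀ (p : A₁ → Bool) xs {x} → x ∈ xs → p x ≡ true → 1 ≤ countᵇ p xs
countᵇ-pos p (y ∷ xs) (here refl) px rewrite px = s≤s z≤n
countᵇ-pos p (y ∷ xs) (there x∈) px with p y
... | true  = s≤s z≤n
... | false = countᵇ-pos p xs x∈ px

countᵇ-∧ˡ : ∀ b (p : A₁ → Bool) xs → countᵇ (λ x → b ∧ p x) xs ≡ (if b then countᵇ p xs else 0)
countᵇ-∧ˡ true  p xs = refl
countᵇ-∧ˡ false p xs = countᵇ-none _ xs (λ _ → refl)

countᵇ-filterᵇ : ∀ (p q : A₁ → Bool) xs → countᵇ p (filterᵇ q xs) ≡ countᵇ (λ x → q x ∧ p x) xs
countᵇ-filterᵇ p q []       = refl
countᵇ-filterᵇ p q (x ∷ xs) with q x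
... | false = countᵇ-filterᵇ p q xs
... | true with p x
...   | true  = cong suc (countᵇ-filterᵇ p q xs)
...   | false = countᵇ-filterᵇ p q xs

countᵇ-↭ : ∀ (p : A₁ → Bool) {xs ys} → xs ↭ ys → countᵇ p xs ≡ countᵇ p ys
countᵇ-↭ p ↭-refl = refl
countᵇ-↭ p (prep x xs↭ys) with p x
... | true  = cong suc (countᵇ-↭ p xs↭ys)
... | false = countᵇ-↭ p xs↭ys
countᵇ-↭ p (swap x y xs↭ys) with p x | p y
... | true  | true  = cong (suc ∘ suc) (countᵇ-↭ p xs↭ys)
... | true  | false = cong suc (countᵇ-↭ p xs↭ys)
... | false | true  = cong suc (countᵇ-↭ p xs↭ys)
... | false | false = countᵇ-↭ p xs↭ys
countᵇ-↭ p (↭-trans xs↭ys ys↭zs) = trans (countᵇ-↭ p xs↭ys) (countᵇ-↭ p ys↭zs)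

countᵇ-sameElements : ∀ {xs ys : List A₁} → Unique xs → Unique ys →
  (∀ {x} → x ∈ xs → x ∈ ys) → (∀ {x} → x ∈ ys → x ∈ xs) → ∀ p → countᵇ p xs ≡ countᵇ p ys
countᵇ-sameElements xs! ys! xs⊆ys ys⊆xs p =
  countᵇ-↭ p (∼bag⇒↭ (unique∧set⇒bag xs! ys! (mk⇔ xs⊆ys ys⊆xs)))

sum-map-+ : ∀ (g h : A₁ → ℕ) xs → sum (map (λ x → g x + h x) xs) ≡ sum (map g xs) + sum (map h xs)
sum-map-+ g h []       = refl
sum-map-+ g h (x ∷ xs) =
  trans (cong (g x + h x +_) (sum-map-+ g h xs)) (+-interchange (g x) (h x) _ _)

sum-map-if : ∀ (p : A₁ → Bool) N xs → sum (map (λ x → if p x then N else 0) xs) ≡ countᵇ p xs * N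
sum-map-if p N []       = refl
sum-map-if p N (x ∷ xs) with p x
... | true  = cong (N +_) (sum-map-if p N xs)
... | false = sum-map-if p N xs

countᵇ-cartesianProductWith : ∀ (p : C₁ → Bool) (f : A₁ → B₁ → C₁) xs ys →
  countᵇ p (cartesianProductWith f xs ys) ≡ sum (map (λ x → countᵇ (p ∘ f x) ys) xs)
countᵇ-cartesianProductWith p f []       ys = refl
countᵇ-cartesianProductWith p f (x ∷ xs) ys =
  trans (countᵇ-++ p (map (f x) ys) _)
        (cong₂ _+_ (countᵇ-map p (f x) ys) (countᵇ-cartesianProductWith p f xs ys))

Unique-map-injectiveOn : ∀ (f : A₁ → B₁) xs → Unique xs →
  (∀ {x y} → x ∈ xs → y ∈ xs → f x ≡ f y → x ≡ y) → Unique (map f xs)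
Unique-map-injectiveOn f []       []         _   = []
Unique-map-injectiveOn f (x ∷ xs) (x∉ ∷ xs!) inj =
  head∉ xs x∉ (λ y∈ → inj (here refl) (there y∈)) ∷ Unique-map-injectiveOn f xs xs! (λ a b → inj (there a) (there b))
  where
  head∉ : ∀ ys → All (x ≢_) ys → (∀ {y} → y ∈ ys → f x ≡ f y → x ≡ y) → All (f x ≢_) (map f ys)
  head∉ []       []         _   = []
  head∉ (y ∷ ys) (x≢y ∷ ne) inj′ = (x≢y ∘ inj′ (here refl)) ∷ head∉ ys ne (inj′ ∘ there)

Unique-cartesianProductWith-injectiveOn : ∀ (f : A₁ → B₁ → C₁) xs ys → Unique xs → Unique ys →
  (∀ {a a′ b b′} → a ∈ xs → a′ ∈ xs → b ∈ ys → b′ ∈ ys → f a b ≡ f a′ b′ → a ≡ a′ × b ≡ b′) →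
  Unique (cartesianProductWith f xs ys)
Unique-cartesianProductWith-injectiveOn f []       ys _          _   _   = []
Unique-cartesianProductWith-injectiveOn f (x ∷ xs) ys (x∉ ∷ xs!) ys! inj =
  Unique.++⁺ (Unique-map-injectiveOn (f x) ys ys! (λ b∈ b′∈ → proj₂ ∘ inj (here refl) (here refl) b∈ b′∈))
             (Unique-cartesianProductWith-injectiveOn f xs ys xs! ys! (λ a∈ a′∈ → inj (there a∈) (there a′∈)))
             disjoint
  where
  disjoint : ∀ {c} → ¬ (c ∈ map (f x) ys × c ∈ cartesianProductWith f xs ys)
  disjoint (c∈₁ , c∈₂) with ∈-map⁻ (f x) c∈₁ | ∈-cartesianProductWith⁻ f xs ys c∈₂
  ... | (b , b∈ , refl) | (a′ , b′ , a′∈ , b′∈ , eq) =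
    All¬⇒¬Any x∉ (subst (_∈ xs) (sym (proj₁ (inj (here refl) (there a′∈) b∈ b′∈ eq))) a′∈)

-- Permutations

∧-true⁻ : ∀ {x y} → x ∧ y ≡ true → x ≡ true × y ≡ true
∧-true⁻ {x} {y} eq = ∧-conicalˡ x y eq , ∧-conicalʳ x y eq

∧-true⁺ : ∀ {x y} → x ≡ true → y ≡ true → x ∧ y ≡ true
∧-true⁺ refl refl = refl

≡ᵇ⇒≡′ : ∀ {a b} → (a ≡ᵇ b) ≡ true → a ≡ b
≡ᵇ⇒≡′ {a} {b} eq = ≡ᵇ⇒≡ a b (Equivalence.from T-≡ eq)

≢⇒≡ᵇ-false : ∀ {a b} → a ≢ b → (a ≡ᵇ b) ≡ false
≢⇒≡ᵇ-false {a} {b} a≢b with a ≡ᵇ b in eq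
... | true  = ⊥-elim (a≢b (≡ᵇ⇒≡′ eq))
... | false = refl

<ᵇ⇒<′ : ∀ {a b} → (a <ᵇ b) ≡ true → a < b
<ᵇ⇒<′ {a} {b} eq = <ᵇ⇒< a b (Equivalence.from T-≡ eq)

<⇒<ᵇ′ : ∀ {a b} → a < b → (a <ᵇ b) ≡ true
<⇒<ᵇ′ a<b = Equivalence.to T-≡ (<⇒<ᵇ a<b)

≮⇒<ᵇ-false : ∀ {a b} → ¬ a < b → (a <ᵇ b) ≡ false
≮⇒<ᵇ-false {a} {b} a≮b with a <ᵇ b in eq
... | true  = ⊥-elim (a≮b (<ᵇ⇒<′ eq))
... | false = refl

-- `words` and `perms` are defined through helpers local to their where-blocks,
-- which cannot be named here; the type of the inner induction is therefore
-- left for unification to infer from the single use.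
mutual
  words-suc : ∀ al m → words al (suc m) ≡ cartesianProductWith (flip _∷_) (words al m) al
  words-suc al m with words al m
  ... | ws = words-suc-go al m ws

  private
    words-suc-go : (al : List ℕ) (m : ℕ) (ws : List (List ℕ)) → _
    words-suc-go al m []       = refl
    words-suc-go al m (w ∷ ws) = cong (map (_∷ w) al ++_) (words-suc-go al m ws)

mutual
  perms-filterᵇ : ∀ n → perms n ≡ filterᵇ distinctᵇ (words (range n) n)
  perms-filterᵇ n with words (range n) n
  ... | ws = perms-go n ws

  private
    perms-go : (n : ℕ) (ws : List (List ℕ)) → _
    perms-go n []       = refl
    perms-go n (w ∷ ws) with distinctᵇ w
    ... | true  = cong (w ∷_) (perms-go n ws)
    ... | false = perms-go n ws

∈-words⁻ : ∀ al m {w} → w ∈ words al m → length w ≡ m × All (_∈ al) w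
∈-words⁻ al zero    (here refl) = refl , []
∈-words⁻ al (suc m) {w} w∈ rewrite words-suc al m
  with ∈-cartesianProductWith⁻ (flip _∷_) (words al m) al w∈
... | (w′ , a , w′∈ , a∈ , refl) = let (len , w′⊆al) = ∈-words⁻ al m w′∈ in cong suc len , a∈ ∷ w′⊆al

∈-words⁺ : ∀ al m w → length w ≡ m → All (_∈ al) w → w ∈ words al m
∈-words⁺ al zero    []      refl [] = here refl
∈-words⁺ al (suc m) (a ∷ w) len  (a∈ ∷ w⊆al) rewrite words-suc al m =
  ∈-cartesianProductWith⁺ (flip _∷_) (∈-words⁺ al m w (suc-injective len) w⊆al) a∈

words-unique : ∀ al m → Unique al → Unique (words al m)
words-unique al zero    al! = [] ∷ []
words-unique al (suc m) al! rewrite words-suc al m =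
  Unique.cartesianProductWith⁺ (flip _∷_) (×-swap ∘ ∷-injective) (words-unique al m al!) al!

distinctᵇ⇒Unique : ∀ w → distinctᵇ w ≡ true → Unique w
distinctᵇ⇒Unique []      _  = []
distinctᵇ⇒Unique (a ∷ w) eq = let (a∉ , w!) = ∧-true⁻ eq in notIn w a∉ ∷ distinctᵇ⇒Unique w w!
  where
  notIn : ∀ xs → allᵇ (λ b → not (a ≡ᵇ b)) xs ≡ true → All (a ≢_) xs
  notIn []       _  = []
  notIn (x ∷ xs) eq with a ≡ᵇ x in a≡ᵇx
  ... | false = (λ { refl → contradiction (trans (sym a≡ᵇx) (Equivalence.to T-≡ (≡⇒≡ᵇ a a refl))) λ () })
                ∷ notIn xs eq

Unique⇒distinctᵇ : ∀ w → Unique w → distinctᵇ w ≡ true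
Unique⇒distinctᵇ []      _          = refl
Unique⇒distinctᵇ (a ∷ w) (a∉ ∷ w!) = cong₂ _∧_ (allNot w a∉) (Unique⇒distinctᵇ w w!)
  where
  allNot : ∀ xs → All (a ≢_) xs → allᵇ (λ b → not (a ≡ᵇ b)) xs ≡ true
  allNot []       []         = refl
  allNot (x ∷ xs) (a≢x ∷ ne) rewrite ≢⇒≡ᵇ-false a≢x = allNot xs ne

Within : ℕ → ℕ → ℕ → Set
Within a b v = a < v × v ≤ b

PermOn : ℕ → ℕ → List ℕ → Set
PermOn a l w = length w ≡ l × Unique w × All (Within a (a + l)) w

∈-range⁻ : ∀ n {v} → v ∈ range n → Within 0 n v
∈-range⁻ n v∈ with ∈-map⁻ suc v∈
... | (i , i∈ , refl) = s≤s z≤n , ∈-upTo⁻ i∈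

∈-range⁺ : ∀ n {v} → Within 0 n v → v ∈ range n
∈-range⁺ n {suc i} (_ , i<n) = ∈-map⁺ suc (∈-upTo⁺ i<n)

range-unique : ∀ n → Unique (range n)
range-unique n = Unique.map⁺ suc-injective (Unique.upTo⁺ n)

∈-perms⁻ : ∀ n {w} → w ∈ perms n → PermOn 0 n w
∈-perms⁻ n {w} w∈ rewrite perms-filterᵇ n with ∈-filter⁻ (T? ∘ distinctᵇ) w∈
... | (w∈words , dist) = let (len , w⊆range) = ∈-words⁻ (range n) n w∈words in
  len , distinctᵇ⇒Unique w (Equivalence.to T-≡ dist) , All.map (∈-range⁻ n) w⊆range

∈-perms⁺ : ∀ n {w} → PermOn 0 n w → w ∈ perms n
∈-perms⁺ n {w} (len , w! , w⊆range) rewrite perms-filterᵇ n =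
  ∈-filter⁺ (T? ∘ distinctᵇ) (∈-words⁺ (range n) n w len (All.map (∈-range⁺ n) w⊆range))
            (Equivalence.from T-≡ (Unique⇒distinctᵇ w w!))

perms-unique : ∀ n → Unique (perms n)
perms-unique n rewrite perms-filterᵇ n =
  Unique.filter⁺ (T? ∘ distinctᵇ) (words-unique (range n) n (range-unique n))
-- Occurrences of 12…k and of 132

-- `sameᵇ` and `compatᵇ` copy the helpers local to `orderIsoᵇ`.  Those live in a
-- where-module parametrised by the whole argument lists; in the anchor these
-- parameters (P, Q) are distinct variables, so unification can infer the type
-- of the inner induction.
sameᵇ : Bool → Bool → Bool
sameᵇ true  true  = true
sameᵇ false false = true
sameᵇ _     _     = false

compatᵇ : ℕ → ℕ → List ℕ → List ℕ → Bool
compatᵇ a t []       []       = true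
compatᵇ a t (b ∷ bs) (u ∷ us) = sameᵇ (a <ᵇ b) (t <ᵇ u) ∧ sameᵇ (b <ᵇ a) (u <ᵇ t) ∧ compatᵇ a t bs us
compatᵇ a t _        _        = false

mutual
  private
    orderIsoᵇ-cons-go : (a t : ℕ) (P Q x y : List ℕ) (r : Bool) → _

    orderIsoᵇ-cons-anchor : ∀ a t b u x y → (a <ᵇ b) ≡ true → (t <ᵇ u) ≡ true → (b <ᵇ a) ≡ false → (u <ᵇ t) ≡ false →
      orderIsoᵇ (a ∷ b ∷ x) (t ∷ u ∷ y) ≡ compatᵇ a t (b ∷ x) (u ∷ y) ∧ orderIsoᵇ (b ∷ x) (u ∷ y)
    orderIsoᵇ-cons-anchor a t b u x y ab tu ba ut rewrite ab | tu | ba | ut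
      with b ∷ x | u ∷ y | orderIsoᵇ (b ∷ x) (u ∷ y)
    ... | P | Q | r = orderIsoᵇ-cons-go a t P Q x y r

    orderIsoᵇ-cons-go a t P Q []       []       r = refl
    orderIsoᵇ-cons-go a t P Q []       (u ∷ us) r = refl
    orderIsoᵇ-cons-go a t P Q (b ∷ bs) []       r = refl
    orderIsoᵇ-cons-go a t P Q (b ∷ bs) (u ∷ us) r with a <ᵇ b | t <ᵇ u | b <ᵇ a | u <ᵇ t
    ... | true  | true  | true  | true  = orderIsoᵇ-cons-go a t P Q bs us r
    ... | true  | true  | true  | false = refl
    ... | true  | true  | false | true  = refl
    ... | true  | true  | false | false = orderIsoᵇ-cons-go a t P Q bs us r
    ... | true  | false | _     | _     = refl
    ... | false | true  | _     | _     = refl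
    ... | false | false | true  | true  = orderIsoᵇ-cons-go a t P Q bs us r
    ... | false | false | true  | false = refl
    ... | false | false | false | true  = refl
    ... | false | false | false | false = orderIsoᵇ-cons-go a t P Q bs us r

orderIsoᵇ-cons : ∀ a t x y → orderIsoᵇ (a ∷ x) (t ∷ y) ≡ compatᵇ a t x y ∧ orderIsoᵇ x y
orderIsoᵇ-cons a t x y = orderIsoᵇ-cons-go a t x y x y (orderIsoᵇ x y)

increasingᵇ : List ℕ → Bool
increasingᵇ []       = true
increasingᵇ (t ∷ ts) = allᵇ (t <ᵇ_) ts ∧ increasingᵇ ts

Increasing : List ℕ → Set
Increasing []       = ⊤
Increasing (a ∷ as) = All (a <_) as × Increasing as

<ᵇ-asym : ∀ {t u} → (t <ᵇ u) ≡ true → (u <ᵇ t) ≡ false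
<ᵇ-asym {t} {u} t<u = ≮⇒<ᵇ-false (<-asym (<ᵇ⇒<′ {t} {u} t<u))

compatᵇ-increasing : ∀ a t p s → All (a <_) p → length p ≡ length s → compatᵇ a t p s ≡ allᵇ (t <ᵇ_) s
compatᵇ-increasing a t []      []      _           _   = refl
compatᵇ-increasing a t (b ∷ p) (u ∷ s) (a<b ∷ a<p) len
  rewrite <⇒<ᵇ′ a<b | ≮⇒<ᵇ-false (<-asym a<b) with t <ᵇ u in t<u
... | true rewrite <ᵇ-asym {t} {u} t<u = compatᵇ-increasing a t p s a<p (suc-injective len)
... | false = refl

orderIsoᵇ-increasing : ∀ p s → Increasing p → length p ≡ length s → orderIsoᵇ p s ≡ increasingᵇ s
orderIsoᵇ-increasing []      []      _          _   = refl
orderIsoᵇ-increasing (a ∷ p) (t ∷ s) (a<p , p↑) len =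
  trans (orderIsoᵇ-cons a t p s)
        (cong₂ _∧_ (compatᵇ-increasing a t p s a<p (suc-injective len))
                   (orderIsoᵇ-increasing p s p↑ (suc-injective len)))

applyUpTo-increasing : ∀ (f : ℕ → ℕ) → (∀ {i j} → i < j → f i < f j) → ∀ n → Increasing (applyUpTo f n)
applyUpTo-increasing f f-mono zero    = tt
applyUpTo-increasing f f-mono (suc n) =
  All.tabulate (λ v∈ → let (_ , _ , v≡) = ∈-applyUpTo⁻ (f ∘ suc) v∈ in subst (f 0 <_) (sym v≡) (f-mono (s≤s z≤n))) ,
  applyUpTo-increasing (f ∘ suc) (f-mono ∘ s≤s) n

range-increasing : ∀ k → Increasing (range k)
range-increasing k rewrite map-upTo suc k = applyUpTo-increasing suc s≤s k

length-range : ∀ k → length (range k) ≡ k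
length-range k rewrite map-upTo suc k = length-applyUpTo suc k

∈-choose-length : ∀ k π {s} → s ∈ choose k π → length s ≡ k
∈-choose-length zero    π       (here refl) = refl
∈-choose-length (suc k) (a ∷ π) s∈ with ∈-++⁻ (map (a ∷_) (choose k π)) s∈
... | inj₁ s∈₁ = let (s′ , s′∈ , s≡) = ∈-map⁻ (a ∷_) s∈₁ in trans (cong length s≡) (cong suc (∈-choose-length k π s′∈))
... | inj₂ s∈₂ = ∈-choose-length (suc k) π s∈₂

incAbove : ℕ → ℕ → List ℕ → ℕ
incAbove zero    b π       = 1
incAbove (suc k) b []      = 0
incAbove (suc k) b (a ∷ π) = (if b <ᵇ a then incAbove k a π else 0) + incAbove (suc k) b π

inc : ℕ → List ℕ → ℕ
inc zero    π       = 1
inc (suc k) []      = 0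
inc (suc k) (a ∷ π) = incAbove k a π + inc (suc k) π

allᵇ-<ᵇ-weaken : ∀ {b a} s → b < a → allᵇ (a <ᵇ_) s ≡ true → allᵇ (b <ᵇ_) s ≡ true
allᵇ-<ᵇ-weaken []      _   _   = refl
allᵇ-<ᵇ-weaken (x ∷ s) b<a a<s = let (a<x , a<s′) = ∧-true⁻ a<s in
  ∧-true⁺ (<⇒<ᵇ′ (<-trans b<a (<ᵇ⇒<′ {_} {x} a<x))) (allᵇ-<ᵇ-weaken s b<a a<s′)

countᵇ-choose-increasingAbove : ∀ k b π →
  countᵇ (λ s → allᵇ (b <ᵇ_) s ∧ increasingᵇ s) (choose k π) ≡ incAbove k b π
countᵇ-choose-increasingAbove zero    b π       = refl
countᵇ-choose-increasingAbove (suc k) b []      = refl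
countᵇ-choose-increasingAbove (suc k) b (a ∷ π) = begin
  countᵇ P (map (a ∷_) (choose k π) ++ choose (suc k) π)
    ≡⟨ countᵇ-++ P (map (a ∷_) (choose k π)) _ ⟩
  countᵇ P (map (a ∷_) (choose k π)) + countᵇ P (choose (suc k) π)
    ≡⟨ cong₂ _+_ (countᵇ-map P (a ∷_) (choose k π)) (countᵇ-choose-increasingAbove (suc k) b π) ⟩
  countᵇ (P ∘ (a ∷_)) (choose k π) + incAbove (suc k) b π
    ≡⟨ cong (_+ incAbove (suc k) b π) starting-with-a ⟩
  (if b <ᵇ a then incAbove k a π else 0) + incAbove (suc k) b π ∎
  where
  open ≡-Reasoning
  P : List ℕ → Bool
  P s = allᵇ (b <ᵇ_) s ∧ increasingᵇ s
  starting-with-a : countᵇ (P ∘ (a ∷_)) (choose k π) ≡ (if b <ᵇ a then incAbove k a π else 0)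
  starting-with-a with b <ᵇ a in b<a
  ... | false = countᵇ-none _ (choose k π) (λ _ → refl)
  ... | true  = trans (countᵇ-ext (choose k π) drop-b) (countᵇ-choose-increasingAbove k a π)
    where
    drop-b : ∀ s → allᵇ (b <ᵇ_) s ∧ (allᵇ (a <ᵇ_) s ∧ increasingᵇ s) ≡ allᵇ (a <ᵇ_) s ∧ increasingᵇ s
    drop-b s with allᵇ (a <ᵇ_) s in a<s
    ... | true rewrite allᵇ-<ᵇ-weaken s (<ᵇ⇒<′ b<a) a<s = refl
    ... | false = ∧-zeroʳ (allᵇ (b <ᵇ_) s)

countᵇ-choose-increasing : ∀ k π → countᵇ increasingᵇ (choose k π) ≡ inc k π
countᵇ-choose-increasing zero    π       = refl
countᵇ-choose-increasing (suc k) []      = refl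
countᵇ-choose-increasing (suc k) (a ∷ π) =
  trans (countᵇ-++ increasingᵇ (map (a ∷_) (choose k π)) _)
        (cong₂ _+_ (trans (countᵇ-map increasingᵇ (a ∷_) (choose k π)) (countᵇ-choose-increasingAbove k a π))
                   (countᵇ-choose-increasing (suc k) π))

occ-incPat : ∀ k π → occ (incPat k) π ≡ inc k π
occ-incPat k π = begin
  countᵇ (orderIsoᵇ (range k)) (choose (length (range k)) π)
    ≡⟨ cong (λ z → countᵇ (orderIsoᵇ (range k)) (choose z π)) (length-range k) ⟩
  countᵇ (orderIsoᵇ (range k)) (choose k π)
    ≡⟨ countᵇ-cong (choose k π) (λ {s} s∈ → orderIsoᵇ-increasing (range k) s (range-increasing k)
                                              (trans (length-range k) (sym (∈-choose-length k π s∈)))) ⟩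
  countᵇ increasingᵇ (choose k π)
    ≡⟨ countᵇ-choose-increasing k π ⟩
  inc k π ∎
  where open ≡-Reasoning

betweenᵇ : ℕ → ℕ → ℕ → Bool
betweenᵇ a b c = (a <ᵇ c) ∧ (c <ᵇ b)

count21Above : ℕ → List ℕ → ℕ
count21Above a []      = 0
count21Above a (b ∷ w) = countᵇ (betweenᵇ a b) w + count21Above a w

count132 : List ℕ → ℕ
count132 []      = 0
count132 (a ∷ w) = count21Above a w + count132 w

≡true⇔⇒≡ : ∀ {x y : Bool} → (x ≡ true → y ≡ true) → (y ≡ true → x ≡ true) → x ≡ y
≡true⇔⇒≡ {true}  {true}  _ _ = refl
≡true⇔⇒≡ {true}  {false} x⇒y _ = sym (x⇒y refl)
≡true⇔⇒≡ {false} {true}  _ y⇒x = y⇒x refl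
≡true⇔⇒≡ {false} {false} _ _ = refl

orderIsoᵇ-132 : ∀ a b c → orderIsoᵇ pat132 (a ∷ b ∷ c ∷ []) ≡ betweenᵇ a b c
orderIsoᵇ-132 a b c = ≡true⇔⇒≡ (to a b c) from
  where
  to : ∀ a b c → orderIsoᵇ pat132 (a ∷ b ∷ c ∷ []) ≡ true → betweenᵇ a b c ≡ true
  to a b c iso with a <ᵇ b | b <ᵇ a | a <ᵇ c | c <ᵇ a | b <ᵇ c | c <ᵇ b
  to a b c () | false | _     | _     | _     | _     | _
  to a b c () | true  | true  | _     | _     | _     | _
  to a b c () | true  | false | false | _     | _     | _
  to a b c () | true  | false | true  | true  | _     | _
  to a b c () | true  | false | true  | false | true  | _
  to a b c () | true  | false | true  | false | false | false
  to a b c _  | true  | false | true  | false | false | true  = refl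
  from : betweenᵇ a b c ≡ true → orderIsoᵇ pat132 (a ∷ b ∷ c ∷ []) ≡ true
  from a<c<b with ∧-true⁻ a<c<b
  ... | a<c , c<b
    with a <ᵇ b | <⇒<ᵇ′ a<b | b <ᵇ a | ≮⇒<ᵇ-false (<-asym a<b) | c <ᵇ a | <ᵇ-asym {a} {c} a<c | b <ᵇ c | <ᵇ-asym {c} {b} c<b
    where a<b = <-trans (<ᵇ⇒<′ {a} {c} a<c) (<ᵇ⇒<′ {c} {b} c<b)
  ... | _ | refl | _ | refl | _ | refl | _ | refl rewrite a<c | c<b = refl

countᵇ-choose1 : ∀ (f : List ℕ → Bool) w → countᵇ f (choose 1 w) ≡ countᵇ (λ c → f (c ∷ [])) w
countᵇ-choose1 f []      = refl
countᵇ-choose1 f (c ∷ w) with f (c ∷ [])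
... | true  = cong suc (countᵇ-choose1 f w)
... | false = countᵇ-choose1 f w

countᵇ-choose2-132 : ∀ a w → countᵇ (orderIsoᵇ pat132 ∘ (a ∷_)) (choose 2 w) ≡ count21Above a w
countᵇ-choose2-132 a []      = refl
countᵇ-choose2-132 a (b ∷ w) =
  trans (countᵇ-++ P (map (b ∷_) (choose 1 w)) _)
        (cong₂ _+_ (trans (countᵇ-map P (b ∷_) (choose 1 w))
                          (trans (countᵇ-choose1 (P ∘ (b ∷_)) w) (countᵇ-ext w (orderIsoᵇ-132 a b))))
                   (countᵇ-choose2-132 a w))
  where
  P : List ℕ → Bool
  P = orderIsoᵇ pat132 ∘ (a ∷_)

occ-132 : ∀ π → occ pat132 π ≡ count132 π
occ-132 []      = refl
occ-132 (a ∷ π) =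
  trans (countᵇ-++ (orderIsoᵇ pat132) (map (a ∷_) (choose 2 π)) _)
        (cong₂ _+_ (trans (countᵇ-map (orderIsoᵇ pat132) (a ∷_) (choose 2 π)) (countᵇ-choose2-132 a π))
                   (occ-132 π))
-- Blocks of consecutive values

shift : ℕ → List ℕ → List ℕ
shift j = map (j +_)

unshift : ℕ → List ℕ → List ℕ
unshift j = map (_∸ j)

shift-unshift : ∀ j xs → All (j <_) xs → shift j (unshift j xs) ≡ xs
shift-unshift j []       []           = refl
shift-unshift j (x ∷ xs) (j<x ∷ j<xs) = cong₂ _∷_ (m+[n∸m]≡n (<⇒≤ j<x)) (shift-unshift j xs j<xs)

shift-injective : ∀ j {xs ys} → shift j xs ≡ shift j ys → xs ≡ ys
shift-injective j {[]}     {[]}     _  = refl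
shift-injective j {x ∷ xs} {y ∷ ys} eq =
  let (x≡y , xs≡ys) = ∷-injective eq in cong₂ _∷_ (+-cancelˡ-≡ j x y x≡y) (shift-injective j xs≡ys)

PermOn-low++high : ∀ {a l₁ l₂ xs ys} → PermOn a l₁ xs → PermOn (a + l₁) l₂ ys → PermOn a (l₁ + l₂) (xs ++ ys)
PermOn-low++high {a} {l₁} {l₂} {xs} (len-xs , xs! , xs∈) (len-ys , ys! , ys∈) =
  trans (length-++ xs) (cong₂ _+_ len-xs len-ys) ,
  Unique.++⁺ xs! ys! (λ (x∈ , y∈) → <⇒≢ (≤-<-trans (proj₂ (All.lookup xs∈ x∈)) (proj₁ (All.lookup ys∈ y∈))) refl) ,
  ++⁺ (All.map (λ (a<v , v≤) → a<v , ≤-trans v≤ (≤-trans (m≤m+n (a + l₁) l₂) (≤-reflexive (+-assoc a l₁ l₂)))) xs∈)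
      (All.map (λ (a<v , v≤) → ≤-<-trans (m≤m+n a l₁) a<v , ≤-trans v≤ (≤-reflexive (+-assoc a l₁ l₂))) ys∈)

PermOn-high++low : ∀ {a l₁ l₂ xs ys} → PermOn (a + l₂) l₁ xs → PermOn a l₂ ys → PermOn a (l₂ + l₁) (xs ++ ys)
PermOn-high++low {a} {l₁} {l₂} {xs} (len-xs , xs! , xs∈) (len-ys , ys! , ys∈) =
  trans (length-++ xs) (trans (cong₂ _+_ len-xs len-ys) (+-comm l₁ l₂)) ,
  Unique.++⁺ xs! ys! (λ (x∈ , y∈) → <⇒≢ (≤-<-trans (proj₂ (All.lookup ys∈ y∈)) (proj₁ (All.lookup xs∈ x∈))) refl) ,
  ++⁺ (All.map (λ (a<v , v≤) → ≤-<-trans (m≤m+n a l₂) a<v , ≤-trans v≤ (≤-reflexive (+-assoc a l₂ l₁))) xs∈)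
      (All.map (λ (a<v , v≤) → a<v , ≤-trans v≤ (≤-trans (m≤m+n (a + l₂) l₁) (≤-reflexive (+-assoc a l₂ l₁)))) ys∈)

PermOn-singleton : ∀ a → PermOn a 1 [ suc a ]
PermOn-singleton a = refl , [] ∷ [] , (≤-refl , ≤-reflexive (+-comm 1 a)) ∷ []

PermOn-pair : ∀ a → PermOn a 2 (suc a ∷ suc (suc a) ∷ [])
PermOn-pair a = subst (λ z → PermOn a 2 (suc a ∷ suc z ∷ [])) (+-comm a 1)
                      (PermOn-low++high (PermOn-singleton a) (PermOn-singleton (a + 1)))

PermOn-≡length : ∀ {a l l′ w} → l ≡ l′ → PermOn a l w → PermOn a l′ w
PermOn-≡length refl perm = perm

PermOn-shift : ∀ j {a l w} → PermOn a l w → PermOn (j + a) l (shift j w)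
PermOn-shift j {a} {l} {w} (len , w! , w∈) =
  trans (length-map (j +_) w) len ,
  Unique.map⁺ (+-cancelˡ-≡ j _ _) w! ,
  All-map⁺ (All.map (λ (a<v , v≤) → +-monoʳ-< j a<v , ≤-trans (+-monoʳ-≤ j v≤) (≤-reflexive (sym (+-assoc j a l)))) w∈)

PermOn-unshift : ∀ j {l w} → PermOn j l w → PermOn 0 l (unshift j w)
PermOn-unshift j {l} {w} (len , w! , w∈) =
  trans (length-map (_∸ j) w) len ,
  Unique-map-injectiveOn (_∸ j) w w! (λ x∈ y∈ eq → trans (sym (m∸n+n≡m (j≤ x∈))) (trans (cong (_+ j) eq) (m∸n+n≡m (j≤ y∈)))) ,
  All-map⁺ (All.map (λ (j<v , v≤) → m<n⇒0<n∸m j<v , ≤-trans (∸-monoˡ-≤ j v≤) (≤-reflexive (m+n∸m≡n j l))) w∈)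
  where
  j≤ : ∀ {x} → x ∈ w → j ≤ x
  j≤ x∈ = <⇒≤ (proj₁ (All.lookup w∈ x∈))

PermOn-< : ∀ {n w} → PermOn 0 n w → All (_< suc n) w
PermOn-< (_ , _ , w∈) = All.map (λ (_ , v≤n) → s≤s v≤n) w∈

length-≤-remove : ∀ t {w} → Unique w → length w ≤ suc (length (filter (¬? ∘ (_≟ t)) w))
length-≤-remove t {[]}    _          = z≤n
length-≤-remove t {x ∷ w} (x∉ ∷ w!) with x ≟ t
... | yes refl = s≤s (≤-reflexive (sym (cong length
                   (trans (filter-reject (¬? ∘ (_≟ t)) (λ t≢t → t≢t refl))
                          (filter-all (¬? ∘ (_≟ t)) (All.map (_∘ sym) x∉))))))
... | no  x≢t  = ≤-trans (s≤s (length-≤-remove t w!))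
                         (≤-reflexive (cong (suc ∘ length) (sym (filter-accept (¬? ∘ (_≟ t)) x≢t))))

length-Unique-Within′ : ∀ d a {w} → Unique w → All (Within a (a + d)) w → length w ≤ d
length-Unique-Within′ zero    a {[]}    _  _                    = z≤n
length-Unique-Within′ zero    a {x ∷ w} _  ((a<x , x≤a+0) ∷ _) = ⊥-elim (<⇒≱ a<x (≤-trans x≤a+0 (≤-reflexive (+-identityʳ a))))
length-Unique-Within′ (suc d) a {w}     w! w∈ =
  ≤-trans (length-≤-remove t w!)
          (s≤s (length-Unique-Within′ d a (Unique.filter⁺ (¬? ∘ (_≟ t)) w!) (All.tabulate below-t)))
  where
  t = a + suc d
  below-t : ∀ {v} → v ∈ filter (¬? ∘ (_≟ t)) w → Within a (a + d) v
  below-t v∈ = let (v∈w , v≢t) = ∈-filter⁻ (¬? ∘ (_≟ t)) v∈ ; (a<v , v≤t) = All.lookup w∈ v∈w in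
    a<v , ≤-pred (≤-trans (≤∧≢⇒< v≤t v≢t) (≤-reflexive (+-suc a d)))

length-Unique-Within : ∀ a b {w} → Unique w → All (Within a b) w → length w ≤ b ∸ a
length-Unique-Within a b w! w∈ =
  length-Unique-Within′ (b ∸ a) a w! (All.map (λ (a<v , v≤b) → a<v , ≤-trans v≤b (m≤n+m∸n b a)) w∈)

-- The Dumont condition, and occurrence counts on blocks

evenᵇ-double : ∀ m → evenᵇ (double m) ≡ true
evenᵇ-double zero    = refl
evenᵇ-double (suc m) = trans (not-involutive (evenᵇ (double m))) (evenᵇ-double m)

evenᵇ-suc-double : ∀ m → evenᵇ (suc (double m)) ≡ false
evenᵇ-suc-double m = cong not (evenᵇ-double m)

evenᵇ-double-+ : ∀ t a → evenᵇ (double t + a) ≡ evenᵇ a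
evenᵇ-double-+ zero    a = refl
evenᵇ-double-+ (suc t) a = trans (not-involutive (evenᵇ (double t + a))) (evenᵇ-double-+ t a)

<ᵇ-+ˡ : ∀ j a b → (j + a <ᵇ j + b) ≡ (a <ᵇ b)
<ᵇ-+ˡ zero    a b = refl
<ᵇ-+ˡ (suc j) a b = <ᵇ-+ˡ j a b

dumontᵇ-split : ∀ L x R → All (_< x) L → dumontᵇ (L ++ x ∷ R) ≡ dumontᵇ L ∧ dumontᵇ (x ∷ R)
dumontᵇ-split []           x R _ = refl
dumontᵇ-split (l ∷ [])     x R (l<x ∷ []) rewrite ≮⇒<ᵇ-false (<⇒≯ l<x) | <⇒<ᵇ′ l<x with evenᵇ l
... | true  = refl
... | false = refl
dumontᵇ-split (l ∷ l′ ∷ L) x R (_ ∷ L<x) =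
  trans (cong (step ∧_) (dumontᵇ-split (l′ ∷ L) x R L<x)) (sym (∧-assoc step _ _))
  where step = if evenᵇ l then l′ <ᵇ l else l <ᵇ l′

dumontᵇ-descent : ∀ x r R → r < x → dumontᵇ (x ∷ r ∷ R) ≡ evenᵇ x ∧ dumontᵇ (r ∷ R)
dumontᵇ-descent x r R r<x rewrite ≮⇒<ᵇ-false (<⇒≯ r<x) | <⇒<ᵇ′ r<x with evenᵇ x
... | true  = refl
... | false = refl

dumontᵇ-∷-max : ∀ x Y → Y ≢ [] → All (_< x) Y → dumontᵇ (x ∷ Y) ≡ evenᵇ x ∧ dumontᵇ Y
dumontᵇ-∷-max x []      Y≢[] _         = ⊥-elim (Y≢[] refl)
dumontᵇ-∷-max x (r ∷ R) _    (r<x ∷ _) = dumontᵇ-descent x r R r<x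

dumontᵇ-shift-double : ∀ t σ → dumontᵇ (shift (double t) σ) ≡ dumontᵇ σ
dumontᵇ-shift-double t []          = refl
dumontᵇ-shift-double t (a ∷ [])    = cong not (evenᵇ-double-+ t a)
dumontᵇ-shift-double t (a ∷ b ∷ σ) = cong₂ _∧_ step (dumontᵇ-shift-double t (b ∷ σ))
  where
  step : (if evenᵇ (double t + a) then double t + b <ᵇ double t + a else double t + a <ᵇ double t + b)
       ≡ (if evenᵇ a then b <ᵇ a else a <ᵇ b)
  step rewrite evenᵇ-double-+ t a | <ᵇ-+ˡ (double t) b a | <ᵇ-+ˡ (double t) a b = refl

dumontᵇ-even-hasSmaller : ∀ L {x} → dumontᵇ L ≡ true → x ∈ L → evenᵇ x ≡ true → ∃[ y ] y ∈ L × y < x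
dumontᵇ-even-hasSmaller (a ∷ [])    dum (here refl) x-even rewrite x-even with dum
... | ()
dumontᵇ-even-hasSmaller (a ∷ b ∷ L) dum (here refl) x-even rewrite x-even =
  b , there (here refl) , <ᵇ⇒<′ {b} {a} (proj₁ (∧-true⁻ dum))
dumontᵇ-even-hasSmaller (a ∷ b ∷ L) dum (there x∈)  x-even =
  let (y , y∈ , y<x) = dumontᵇ-even-hasSmaller (b ∷ L) (proj₂ (∧-true⁻ {if evenᵇ a then b <ᵇ a else a <ᵇ b} dum)) x∈ x-even
  in y , there y∈ , y<x

countᵇ-prefix : ∀ (p : A₁ → Bool) xs ys → countᵇ p xs ≤ countᵇ p (xs ++ ys)
countᵇ-prefix p xs ys = ≤-trans (m≤m+n (countᵇ p xs) (countᵇ p ys)) (≤-reflexive (sym (countᵇ-++ p xs ys)))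

countᵇ-betweenᵇ-below : ∀ a b ys → All (_< a) ys → countᵇ (betweenᵇ a b) ys ≡ 0
countᵇ-betweenᵇ-below a b ys ys<a =
  countᵇ-none (betweenᵇ a b) ys (λ {c} c∈ → cong (_∧ (c <ᵇ b)) (≮⇒<ᵇ-false (<⇒≯ (All.lookup ys<a c∈))))

count21Above-below : ∀ a ys → All (_< a) ys → count21Above a ys ≡ 0
count21Above-below a []       _             = refl
count21Above-below a (b ∷ ys) (_ ∷ ys<a) = cong₂ _+_ (countᵇ-betweenᵇ-below a b ys ys<a) (count21Above-below a ys ys<a)

count21Above-++-below : ∀ a xs ys → All (_< a) ys → count21Above a (xs ++ ys) ≡ count21Above a xs
count21Above-++-below a []       ys ys<a = count21Above-below a ys ys<a
count21Above-++-below a (b ∷ xs) ys ys<a = cong₂ _+_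
  (trans (countᵇ-++ (betweenᵇ a b) xs ys)
         (trans (cong (countᵇ (betweenᵇ a b) xs +_) (countᵇ-betweenᵇ-below a b ys ys<a)) (+-identityʳ _)))
  (count21Above-++-below a xs ys ys<a)

count132-++-separated : ∀ xs ys → (∀ {x} → x ∈ xs → All (_< x) ys) → count132 (xs ++ ys) ≡ count132 xs + count132 ys
count132-++-separated []       ys ys<xs = refl
count132-++-separated (a ∷ xs) ys ys<xs =
  trans (cong₂ _+_ (count21Above-++-below a xs ys (ys<xs (here refl))) (count132-++-separated xs ys (ys<xs ∘ there)))
        (sym (+-assoc (count21Above a xs) _ _))

count21Above-∷ʳ-max : ∀ a L x → All (_< x) L → count21Above a (L ++ [ x ]) ≡ count21Above a L
count21Above-∷ʳ-max a []      x _            = refl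
count21Above-∷ʳ-max a (b ∷ L) x (b<x ∷ L<x) = cong₂ _+_
  (trans (countᵇ-++ (betweenᵇ a b) L [ x ]) (trans (cong (countᵇ (betweenᵇ a b) L +_) x-not-between) (+-identityʳ _)))
  (count21Above-∷ʳ-max a L x L<x)
  where
  x-not-between : countᵇ (betweenᵇ a b) [ x ] ≡ 0
  x-not-between rewrite ≮⇒<ᵇ-false (<⇒≯ b<x) | ∧-zeroʳ (a <ᵇ x) = refl

count132-∷ʳ-max : ∀ L x → All (_< x) L → count132 (L ++ [ x ]) ≡ count132 L
count132-∷ʳ-max []      x _            = refl
count132-∷ʳ-max (a ∷ L) x (_ ∷ L<x) = cong₂ _+_ (count21Above-∷ʳ-max a L x L<x) (count132-∷ʳ-max L x L<x)

count132-∷-max : ∀ x R → All (_< x) R → count132 (x ∷ R) ≡ count132 R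
count132-∷-max x R R<x = cong (_+ count132 R) (count21Above-below x R R<x)

count21Above-shift : ∀ j a σ → count21Above (j + a) (shift j σ) ≡ count21Above a σ
count21Above-shift j a []      = refl
count21Above-shift j a (b ∷ σ) = cong₂ _+_ shifted (count21Above-shift j a σ)
  where
  shifted : countᵇ (betweenᵇ (j + a) (j + b)) (shift j σ) ≡ countᵇ (betweenᵇ a b) σ
  shifted = trans (countᵇ-map (betweenᵇ (j + a) (j + b)) (j +_) σ)
                  (countᵇ-ext σ (λ c → cong₂ _∧_ (<ᵇ-+ˡ j a c) (<ᵇ-+ˡ j c b)))

count132-shift : ∀ j σ → count132 (shift j σ) ≡ count132 σ
count132-shift j []      = refl
count132-shift j (a ∷ σ) = cong₂ _+_ (count21Above-shift j a σ) (count132-shift j σ)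

count21Above-prefix : ∀ a xs ys → count21Above a xs ≤ count21Above a (xs ++ ys)
count21Above-prefix a []       ys = z≤n
count21Above-prefix a (b ∷ xs) ys = +-mono-≤ (countᵇ-prefix (betweenᵇ a b) xs ys) (count21Above-prefix a xs ys)

count21Above-suffix : ∀ a xs ys → count21Above a ys ≤ count21Above a (xs ++ ys)
count21Above-suffix a []       ys = ≤-refl
count21Above-suffix a (b ∷ xs) ys = ≤-trans (count21Above-suffix a xs ys) (m≤n+m _ _)

count132-prefix : ∀ xs ys → count132 xs ≤ count132 (xs ++ ys)
count132-prefix []       ys = z≤n
count132-prefix (a ∷ xs) ys = +-mono-≤ (count21Above-prefix a xs ys) (count132-prefix xs ys)

count132-suffix : ∀ xs ys → count132 ys ≤ count132 (xs ++ ys)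
count132-suffix []       ys = ≤-refl
count132-suffix (a ∷ xs) ys = ≤-trans (count132-suffix xs ys) (m≤n+m _ _)

count132-witness : ∀ L n R {l r} → l ∈ L → r ∈ R → l < r → r < n → 0 < count132 (L ++ n ∷ R)
count132-witness (a ∷ L) n R (here refl) r∈ l<r r<n =
  ≤-trans (countᵇ-pos (betweenᵇ a n) R r∈ (∧-true⁺ (<⇒<ᵇ′ l<r) (<⇒<ᵇ′ r<n)))
          (≤-trans (m≤m+n _ _) (≤-trans (count21Above-suffix a L (n ∷ R)) (m≤m+n _ _)))
count132-witness (a ∷ L) n R (there l∈) r∈ l<r r<n =
  ≤-trans (count132-witness L n R l∈ r∈ l<r r<n) (m≤n+m _ _)

incAbove-none : ∀ k b ys → All (_≤ b) ys → incAbove (suc k) b ys ≡ 0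
incAbove-none k b []       _           = refl
incAbove-none k b (a ∷ ys) (a≤b ∷ ys≤b) rewrite ≮⇒<ᵇ-false (≤⇒≯ a≤b) = incAbove-none k b ys ys≤b

incAbove-++-below : ∀ k a xs ys → All (_< a) ys → incAbove k a (xs ++ ys) ≡ incAbove k a xs
incAbove-++-below zero    a xs       ys _    = refl
incAbove-++-below (suc k) a []       ys ys<a = incAbove-none k a ys (All.map <⇒≤ ys<a)
incAbove-++-below (suc k) a (c ∷ xs) ys ys<a with a <ᵇ c in a<c
... | true  = cong₂ _+_ (incAbove-++-below k c xs ys (All.map (λ y<a → <-trans y<a (<ᵇ⇒<′ {a} {c} a<c)) ys<a))
                        (incAbove-++-below (suc k) a xs ys ys<a)
... | false = incAbove-++-below (suc k) a xs ys ys<a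

inc-++-separated : ∀ k xs ys → (∀ {x} → x ∈ xs → All (_< x) ys) →
  inc (suc k) (xs ++ ys) ≡ inc (suc k) xs + inc (suc k) ys
inc-++-separated k []       ys ys<xs = refl
inc-++-separated k (a ∷ xs) ys ys<xs =
  trans (cong₂ _+_ (incAbove-++-below k a xs ys (ys<xs (here refl))) (inc-++-separated k xs ys (ys<xs ∘ there)))
        (sym (+-assoc (incAbove k a xs) _ _))

incAbove-[] : ∀ k a b → incAbove k a [] ≡ incAbove k b []
incAbove-[] zero    a b = refl
incAbove-[] (suc k) a b = refl

incAbove-∷ʳ-max : ∀ k b xs m → b < m → All (_< m) xs →
  incAbove (suc k) b (xs ++ [ m ]) ≡ incAbove (suc k) b xs + incAbove k b xs
incAbove-∷ʳ-max k       b []       m b<m _ rewrite <⇒<ᵇ′ b<m = trans (+-identityʳ _) (incAbove-[] k m b)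
incAbove-∷ʳ-max zero    b (a ∷ xs) m b<m (_ ∷ xs<m) with b <ᵇ a
... | true  = cong suc (incAbove-∷ʳ-max zero b xs m b<m xs<m)
... | false = incAbove-∷ʳ-max zero b xs m b<m xs<m
incAbove-∷ʳ-max (suc k) b (a ∷ xs) m b<m (a<m ∷ xs<m) with b <ᵇ a
... | true  = trans (cong₂ _+_ (incAbove-∷ʳ-max k a xs m a<m xs<m) (incAbove-∷ʳ-max (suc k) b xs m b<m xs<m))
                    (+-interchange (incAbove (suc k) a xs) (incAbove k a xs) (incAbove (suc (suc k)) b xs) (incAbove (suc k) b xs))
... | false = incAbove-∷ʳ-max (suc k) b xs m b<m xs<m

inc-∷ʳ-max : ∀ k xs m → All (_< m) xs → inc (suc k) (xs ++ [ m ]) ≡ inc (suc k) xs + inc k xs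
inc-∷ʳ-max zero    []       m _            = refl
inc-∷ʳ-max (suc k) []       m _            = refl
inc-∷ʳ-max zero    (a ∷ xs) m (_ ∷ xs<m)   = cong suc (inc-∷ʳ-max zero xs m xs<m)
inc-∷ʳ-max (suc k) (a ∷ xs) m (a<m ∷ xs<m) =
  trans (cong₂ _+_ (incAbove-∷ʳ-max k a xs m a<m xs<m) (inc-∷ʳ-max (suc k) xs m xs<m))
        (+-interchange (incAbove (suc k) a xs) (incAbove k a xs) (inc (suc (suc k)) xs) (inc (suc k) xs))

inc-∷-max : ∀ k x R → All (_< x) R → inc (suc (suc k)) (x ∷ R) ≡ inc (suc (suc k)) R
inc-∷-max k x R R<x = cong (_+ inc (suc (suc k)) R) (incAbove-none k x R (All.map <⇒≤ R<x))

incAbove-shift : ∀ k j b σ → incAbove k (j + b) (shift j σ) ≡ incAbove k b σ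
incAbove-shift zero    j b σ       = refl
incAbove-shift (suc k) j b []      = refl
incAbove-shift (suc k) j b (a ∷ σ) rewrite <ᵇ-+ˡ j b a with b <ᵇ a
... | true  = cong₂ _+_ (incAbove-shift k j a σ) (incAbove-shift (suc k) j b σ)
... | false = incAbove-shift (suc k) j b σ

inc-shift : ∀ k j σ → inc k (shift j σ) ≡ inc k σ
inc-shift zero    j σ       = refl
inc-shift (suc k) j []      = refl
inc-shift (suc k) j (a ∷ σ) = cong₂ _+_ (incAbove-shift k j a σ) (inc-shift (suc k) j σ)

incAbove-pos-pred : ∀ k b σ → 0 < incAbove (suc k) b σ → 0 < incAbove k b σ
incAbove-pos-pred zero    b σ       _   = s≤s z≤n
incAbove-pos-pred (suc k) b (a ∷ σ) pos with b <ᵇ a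
... | false = incAbove-pos-pred (suc k) b σ pos
... | true with incAbove (suc k) a σ in eq
...   | suc _ = ≤-trans (incAbove-pos-pred k a σ (subst (0 <_) (sym eq) (s≤s z≤n))) (m≤m+n _ _)
...   | zero  = ≤-trans (incAbove-pos-pred (suc k) b σ pos) (m≤n+m _ _)

incAbove≤inc : ∀ k b σ → incAbove k b σ ≤ inc k σ
incAbove≤inc zero    b σ       = ≤-refl
incAbove≤inc (suc k) b []      = z≤n
incAbove≤inc (suc k) b (a ∷ σ) with b <ᵇ a
... | true  = +-monoʳ-≤ (incAbove k a σ) (incAbove≤inc (suc k) b σ)
... | false = +-mono-≤ z≤n (incAbove≤inc (suc k) b σ)

inc-pos-pred : ∀ k σ → 0 < inc (suc k) σ → 0 < inc k σ
inc-pos-pred zero    σ       _   = s≤s z≤n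
inc-pos-pred (suc k) (a ∷ σ) pos with incAbove (suc k) a σ in eq
... | suc _ = ≤-trans (incAbove-pos-pred k a σ (subst (0 <_) (sym eq) (s≤s z≤n))) (m≤m+n _ _)
... | zero  = ≤-trans (inc-pos-pred (suc k) σ pos) (m≤n+m _ _)

-- Every occurrence of 12…(k+2) contains at least two occurrences of 12…(k+1).
inc-pos⇒≥2 : ∀ k σ → 0 < inc (suc (suc k)) σ → 2 ≤ inc (suc k) σ
inc-pos⇒≥2 k (a ∷ σ) pos with inc (suc (suc k)) σ in eq
... | suc _ = ≤-trans (inc-pos⇒≥2 k σ (subst (0 <_) (sym eq) (s≤s z≤n))) (m≤n+m _ _)
... | zero  = +-mono-≤ (incAbove-pos-pred k a σ pos′) (≤-trans pos′ (incAbove≤inc (suc k) a σ))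
  where pos′ = ≤-trans pos (≤-reflexive (+-identityʳ _))

inc1≡length : ∀ σ → inc 1 σ ≡ length σ
inc1≡length []      = refl
inc1≡length (a ∷ σ) = cong suc (inc1≡length σ)
-- Dumont permutations avoiding 132, split at their maximum

Dumont132 : ℕ → List ℕ → Set
Dumont132 n w = PermOn 0 n w × dumontᵇ w ≡ true × count132 w ≡ 0

isDumont132ᵇ : List ℕ → Bool
isDumont132ᵇ π = dumontᵇ π ∧ (occ pat132 π ≡ᵇ 0)

dumont132 : ℕ → List (List ℕ)
dumont132 n = filterᵇ isDumont132ᵇ (perms n)

D≡countᵇ-dumont132 : ∀ τ r n → D τ r n ≡ countᵇ (λ π → occ τ π ≡ᵇ r) (dumont132 n)
D≡countᵇ-dumont132 τ r n =
  sym (trans (countᵇ-filterᵇ (λ π → occ τ π ≡ᵇ r) isDumont132ᵇ (perms n))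
             (countᵇ-ext (perms n) (λ π → ∧-assoc (dumontᵇ π) _ _)))

dumont132-unique : ∀ n → Unique (dumont132 n)
dumont132-unique n = Unique.filter⁺ (T? ∘ isDumont132ᵇ) (perms-unique n)

∈-dumont132⁻ : ∀ n {w} → w ∈ dumont132 n → Dumont132 n w
∈-dumont132⁻ n {w} w∈ with ∈-filter⁻ (T? ∘ isDumont132ᵇ) w∈
... | w∈perms , isD with ∧-true⁻ {dumontᵇ w} (Equivalence.to T-≡ isD)
... | dum , avoids = ∈-perms⁻ n w∈perms , dum , trans (sym (occ-132 w)) (≡ᵇ⇒≡′ {occ pat132 w} {0} avoids)

∈-dumont132⁺ : ∀ n {w} → Dumont132 n w → w ∈ dumont132 n
∈-dumont132⁺ n {w} (perm , dum , avoids) =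
  ∈-filter⁺ (T? ∘ isDumont132ᵇ) (∈-perms⁺ n perm)
            (Equivalence.from T-≡ (∧-true⁺ dum (cong (_≡ᵇ 0) (trans (occ-132 w) avoids))))

∈-dumont132-length : ∀ n {σ} → σ ∈ dumont132 n → length σ ≡ n
∈-dumont132-length n σ∈ = proj₁ (proj₁ (∈-dumont132⁻ n σ∈))

Unique-++⁻ : ∀ (xs ys : List ℕ) → Unique (xs ++ ys) → Unique xs × Unique ys × (∀ {x y} → x ∈ xs → y ∈ ys → x ≢ y)
Unique-++⁻ []       ys ys!         = [] , ys! , λ ()
Unique-++⁻ (x ∷ xs) ys (x∉ ∷ xsys!) with Unique-++⁻ xs ys xsys!
... | xs! , ys! , apart = ++⁻ˡ xs x∉ ∷ xs! , ys! , apart′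
  where
  apart′ : ∀ {a y} → a ∈ x ∷ xs → y ∈ ys → a ≢ y
  apart′ (here refl) y∈ = All.lookup (++⁻ʳ xs x∉) y∈
  apart′ (there a∈)  y∈ = apart a∈ y∈

PermOn-max-∈ : ∀ a l {w} → PermOn a (suc l) w → suc (a + l) ∈ w
PermOn-max-∈ a l {w} (len , w! , w∈) with suc (a + l) ∈? w
... | yes top∈ = top∈
... | no  top∉ = ⊥-elim (<⇒≱ (≤-reflexive (sym len))
                   (≤-trans (length-Unique-Within a (a + l) w! (All.tabulate below-top)) (≤-reflexive (m+n∸m≡n a l))))
  where
  below-top : ∀ {v} → v ∈ w → Within a (a + l) v
  below-top v∈ = let (a<v , v≤) = All.lookup w∈ v∈ in
    a<v , ≤-pred (≤-trans (≤∧≢⇒< v≤ (λ { refl → top∉ (subst (_∈ w) (+-suc a l) v∈) })) (≤-reflexive (+-suc a l)))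

PermOn-min-∈ : ∀ a l {w} → PermOn a (suc l) w → suc a ∈ w
PermOn-min-∈ a l {w} (len , w! , w∈) with suc a ∈? w
... | yes bottom∈ = bottom∈
... | no  bottom∉ = ⊥-elim (<⇒≱ (≤-reflexive (sym len))
                      (≤-trans (length-Unique-Within (suc a) (a + suc l) w! (All.tabulate above-bottom))
                               (≤-reflexive (trans (cong (_∸ suc a) (+-suc a l)) (m+n∸m≡n a l)))))
  where
  above-bottom : ∀ {v} → v ∈ w → Within (suc a) (a + suc l) v
  above-bottom v∈ = let (a<v , v≤) = All.lookup w∈ v∈ in ≤∧≢⇒< a<v (λ { refl → bottom∉ v∈ }) , v≤

-- Each block is confined to its interval by counting the entries of the other block.
PermOn-blocks : ∀ {n} L R → length L + length R ≡ n → Unique L → Unique R →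
  All (Within 0 n) L → All (Within 0 n) R → (∀ {l r} → l ∈ L → r ∈ R → r < l) →
  PermOn (length R) (length L) L × PermOn 0 (length R) R
PermOn-blocks {n} L R len L! R! L∈ R∈ R<L =
  (refl , L! , All.tabulate L-bounds) , (refl , R! , All.tabulate R-bounds)
  where
  R-bounds : ∀ {r} → r ∈ R → Within 0 (length R) r
  R-bounds {r} r∈ with r ≤? length R
  ... | yes r≤ = proj₁ (All.lookup R∈ r∈) , r≤
  ... | no  r≰ = ⊥-elim (<-irrefl refl (≤-<-trans L≤n∸r (<-≤-trans n∸r<n∸|R| (≤-reflexive n∸|R|≡|L|))))
    where
    L≤n∸r : length L ≤ n ∸ r
    L≤n∸r = length-Unique-Within r n L! (All.tabulate (λ l∈ → R<L l∈ r∈ , proj₂ (All.lookup L∈ l∈)))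
    n∸r<n∸|R| : n ∸ r < n ∸ length R
    n∸r<n∸|R| = ∸-monoʳ-< (≰⇒> r≰) (proj₂ (All.lookup R∈ r∈))
    n∸|R|≡|L| : n ∸ length R ≡ length L
    n∸|R|≡|L| = trans (cong (_∸ length R) (sym len)) (m+n∸n≡m (length L) (length R))
  L-bounds : ∀ {l} → l ∈ L → Within (length R) (length R + length L) l
  L-bounds {l} l∈ with length R <? l
  ... | yes |R|<l = |R|<l , ≤-trans (proj₂ (All.lookup L∈ l∈)) (≤-reflexive (trans (sym len) (+-comm (length L) (length R))))
  ... | no  |R|≮l = ⊥-elim (|R|≮l (m≤pred[n]⇒suc[m]≤n {{>-nonZero l>0}} R≤pred-l))
    where
    l>0 : 0 < l
    l>0 = proj₁ (All.lookup L∈ l∈)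
    R≤pred-l : length R ≤ pred l
    R≤pred-l = length-Unique-Within 0 (pred l) R!
                 (All.tabulate (λ r∈ → proj₁ (All.lookup R∈ r∈) , <⇒≤pred (R<L l∈ r∈)))

count132≡0⇒R<L : ∀ L n R {l r} → count132 (L ++ n ∷ R) ≡ 0 → All (_< n) R → l ∈ L → r ∈ R → l ≢ r → r < l
count132≡0⇒R<L L n R {l} {r} avoids R<n l∈ r∈ l≢r with <-cmp l r
... | tri< l<r _ _ = ⊥-elim (<⇒≱ (count132-witness L n R l∈ r∈ l<r (All.lookup R<n r∈)) (≤-reflexive avoids))
... | tri≈ _ l≡r _ = ⊥-elim (l≢r l≡r)
... | tri> _ _ r<l = r<l

record MaxSplit (N : ℕ) (w : List ℕ) : Set where
  field
    L R          : List ℕ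
    w≡           : w ≡ L ++ suc N ∷ R
    L-perm       : PermOn (length R) (length L) L
    R-perm       : PermOn 0 (length R) R
    length-L+R   : length L + length R ≡ N
    L-dumont     : dumontᵇ L ≡ true
    max∷R-dumont : dumontᵇ (suc N ∷ R) ≡ true
    L-avoids     : count132 L ≡ 0
    R-avoids     : count132 R ≡ 0
    L<max        : All (_< suc N) L
    R<max        : All (_< suc N) R

splitAtMax : ∀ N w → Dumont132 (suc N) w → MaxSplit N w
splitAtMax N w (perm , dum , avoids) with ∈-∃++ (PermOn-max-∈ 0 N perm)
... | L , R , refl = record
  { L = L ; R = R ; w≡ = refl ; L-perm = proj₁ blocks ; R-perm = proj₂ blocks ; length-L+R = length-L+R
  ; L-dumont = proj₁ dumont-parts ; max∷R-dumont = proj₂ dumont-parts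
  ; L-avoids = n≤0⇒n≡0 (≤-trans (count132-prefix L (suc N ∷ R)) (≤-reflexive avoids))
  ; R-avoids = n≤0⇒n≡0 (≤-trans (m≤n+m _ _) (≤-trans (count132-suffix L (suc N ∷ R)) (≤-reflexive avoids)))
  ; L<max = L<max ; R<max = R<max }
  where
  len = proj₁ perm
  w∈ = proj₂ (proj₂ perm)
  parts = Unique-++⁻ L (suc N ∷ R) (proj₁ (proj₂ perm))
  L! = proj₁ parts
  apart = proj₂ (proj₂ parts)
  N∉R : All (suc N ≢_) R
  N∉R with proj₁ (proj₂ parts)
  ... | N∉ ∷ _ = N∉
  R! : Unique R
  R! with proj₁ (proj₂ parts)
  ... | _ ∷ R! = R!
  L∈ : All (Within 0 (suc N)) L
  L∈ = ++⁻ˡ L w∈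
  R∈ : All (Within 0 (suc N)) R
  R∈ with ++⁻ʳ L w∈
  ... | _ ∷ R∈ = R∈
  L<max : All (_< suc N) L
  L<max = All.tabulate (λ l∈ → ≤∧≢⇒< (proj₂ (All.lookup L∈ l∈)) (apart l∈ (here refl)))
  R<max : All (_< suc N) R
  R<max = All.tabulate (λ r∈ → ≤∧≢⇒< (proj₂ (All.lookup R∈ r∈)) (All.lookup N∉R r∈ ∘ sym))
  dumont-parts : dumontᵇ L ≡ true × dumontᵇ (suc N ∷ R) ≡ true
  dumont-parts = ∧-true⁻ {dumontᵇ L} (trans (sym (dumontᵇ-split L (suc N) R L<max)) dum)
  R<L : ∀ {l r} → l ∈ L → r ∈ R → r < l
  R<L l∈ r∈ = count132≡0⇒R<L L (suc N) R avoids R<max l∈ r∈ (apart l∈ (there r∈))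
  length-L+R : length L + length R ≡ N
  length-L+R = suc-injective (trans (sym (+-suc (length L) (length R))) (trans (sym (length-++ L)) len))
  below-max : ∀ {xs} → All (Within 0 (suc N)) xs → All (_< suc N) xs → All (Within 0 N) xs
  below-max xs∈ xs<max = All.zipWith (λ ((0<v , _) , v<max) → 0<v , ≤-pred v<max) (xs∈ , xs<max)
  blocks = PermOn-blocks L R length-L+R L! R! (below-max L∈ L<max) (below-max R∈ R<max) R<L

formO : ℕ → List ℕ → List ℕ
formO m σ = σ ++ [ suc (double m) ]

formA : ℕ → List ℕ → List ℕ
formA m τ = suc (suc (double m)) ∷ formO m τ

formB : ℕ → ℕ → List ℕ → List ℕ → List ℕ
formB m i σ ρ = shift (double (m ∸ i)) σ ++ suc (double m) ∷ suc (suc (double m)) ∷ ρ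

formB-assoc : ∀ m i σ ρ → formB m i σ ρ ≡ (shift (double (m ∸ i)) σ ++ suc (double m) ∷ [ suc (suc (double m)) ]) ++ ρ
formB-assoc m i σ ρ = sym (++-assoc (shift (double (m ∸ i)) σ) (suc (double m) ∷ [ suc (suc (double m)) ]) ρ)

++-∷-≢[] : ∀ (xs : List ℕ) x ys → xs ++ x ∷ ys ≢ []
++-∷-≢[] []      x ys ()
++-∷-≢[] (_ ∷ _) x ys ()

formO-Dumont132 : ∀ m {σ} → Dumont132 (double m) σ → Dumont132 (suc (double m)) (formO m σ)
formO-Dumont132 m {σ} (perm , dum , avoids) =
  PermOn-≡length (+-comm (double m) 1) (PermOn-low++high perm (PermOn-singleton (double m))) ,
  trans (dumontᵇ-split σ (suc (double m)) [] (PermOn-< perm)) (cong₂ _∧_ dum (cong not (evenᵇ-suc-double m))) ,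
  trans (count132-∷ʳ-max σ (suc (double m)) (PermOn-< perm)) avoids

formA-Dumont132 : ∀ m {τ} → Dumont132 (double m) τ → Dumont132 (suc (suc (double m))) (formA m τ)
formA-Dumont132 m {τ} τ-D with formO-Dumont132 m τ-D
... | perm , dum , avoids =
  PermOn-≡length (+-comm (suc (double m)) 1) (PermOn-high++low {0} {1} (PermOn-singleton (suc (double m))) perm) ,
  trans (dumontᵇ-∷-max (suc (suc (double m))) (formO m τ) (++-∷-≢[] τ _ []) (PermOn-< perm)) (cong₂ _∧_ (evenᵇ-double (suc m)) dum) ,
  trans (count132-∷-max (suc (suc (double m))) (formO m τ) (PermOn-< perm)) avoids

formB-Dumont132 : ∀ m i {σ ρ} → i ≤ m → Dumont132 (double i) σ → Dumont132 (double (m ∸ i)) ρ → ρ ≢ [] →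
  Dumont132 (suc (suc (double m))) (formB m i σ ρ)
formB-Dumont132 m i {σ} {ρ} i≤m (σ-perm , σ-dum , σ-avoids) (ρ-perm , ρ-dum , ρ-avoids) ρ≢[] =
  subst (PermOn 0 (suc (suc (double m)))) (sym (formB-assoc m i σ ρ))
        (PermOn-≡length length≡ (PermOn-high++low {0} {double i + 2} {j} Y-perm ρ-perm)) ,
  dumont ,
  avoids
  where
  j = double (m ∸ i)
  j+2i≡2m : j + double i ≡ double m
  j+2i≡2m = trans (double-+ (m ∸ i) i) (cong double (m∸n+n≡m i≤m))
  S = shift j σ
  S-perm : PermOn j (double i) S
  S-perm = subst (λ a → PermOn a (double i) S) (+-identityʳ j) (PermOn-shift j σ-perm)
  Y = S ++ suc (double m) ∷ [ suc (suc (double m)) ]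
  Y-perm : PermOn j (double i + 2) Y
  Y-perm = PermOn-low++high S-perm
             (subst (λ z → PermOn (j + double i) 2 (suc z ∷ [ suc (suc z) ])) j+2i≡2m (PermOn-pair (j + double i)))
  length≡ : j + (double i + 2) ≡ suc (suc (double m))
  length≡ = trans (sym (+-assoc j (double i) 2)) (trans (cong (_+ 2) j+2i≡2m) (+-comm (double m) 2))
  S<2m+1 : All (_< suc (double m)) S
  S<2m+1 = All.map (λ (_ , v≤) → s≤s (≤-trans v≤ (≤-reflexive j+2i≡2m))) (proj₂ (proj₂ S-perm))
  ρ≤j : All (_≤ j) ρ
  ρ≤j = All.map proj₂ (proj₂ (proj₂ ρ-perm))
  ρ<2m+2 : All (_< suc (suc (double m))) ρ
  ρ<2m+2 = All.map (λ v≤j → s≤s (≤-trans v≤j (≤-trans (m≤m+n j (double i)) (≤-trans (≤-reflexive j+2i≡2m) (n≤1+n (double m)))))) ρ≤j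
  dumont : dumontᵇ (formB m i σ ρ) ≡ true
  dumont rewrite dumontᵇ-split S (suc (double m)) (suc (suc (double m)) ∷ ρ) S<2m+1 | dumontᵇ-shift-double (m ∸ i) σ
               | σ-dum | evenᵇ-suc-double m | <⇒<ᵇ′ (n<1+n (suc (double m)))
               | dumontᵇ-∷-max (suc (suc (double m))) ρ ρ≢[] ρ<2m+2 | evenᵇ-double (suc m) = ρ-dum
  avoids : count132 (formB m i σ ρ) ≡ 0
  avoids rewrite formB-assoc m i σ ρ
    | count132-++-separated Y ρ (λ y∈ → All.map (λ v≤j → <-≤-trans (s≤s v≤j) (proj₁ (All.lookup (proj₂ (proj₂ Y-perm)) y∈))) ρ≤j)
    | sym (++-assoc S [ suc (double m) ] [ suc (suc (double m)) ])
    | count132-∷ʳ-max (S ++ [ suc (double m) ]) (suc (suc (double m))) (++⁺ (All.map (λ v< → <-trans v< (n<1+n _)) S<2m+1) (n<1+n _ ∷ []))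
    | count132-∷ʳ-max S (suc (double m)) S<2m+1
    | count132-shift j σ | σ-avoids | ρ-avoids = refl

Dumont132-odd-form : ∀ m w → Dumont132 (suc (double m)) w → ∃[ σ ] Dumont132 (double m) σ × w ≡ formO m σ
Dumont132-odd-form m w w-D with splitAtMax (double m) w w-D
... | record { L = L ; R = [] ; w≡ = w≡ ; L-perm = L-perm ; length-L+R = len ; L-dumont = L-dum ; L-avoids = L-avoids } =
  L , (PermOn-≡length (trans (sym (+-identityʳ (length L))) len) L-perm , L-dum , L-avoids) , w≡
... | record { R = r ∷ R ; max∷R-dumont = dum ; R<max = r<max ∷ _ }
  rewrite dumontᵇ-descent (suc (double m)) r R r<max | evenᵇ-suc-double m with dum
... | ()

PermOn-dumont-offset-even : ∀ j l {L} → PermOn j (suc l) L → dumontᵇ L ≡ true → ∃[ t ] j ≡ double t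
PermOn-dumont-offset-even j l {L} perm dum with parityView j
... | inj₁ even       = even
... | inj₂ (t , refl) with dumontᵇ-even-hasSmaller L dum (PermOn-min-∈ j l perm) (evenᵇ-double (suc t))
... | y , y∈ , y<j+1 = ⊥-elim (<⇒≱ (proj₁ (All.lookup (proj₂ (proj₂ perm)) y∈)) (≤-pred y<j+1))

Dumont132-unshift : ∀ t {l L} → PermOn (double t) l L → dumontᵇ L ≡ true → count132 L ≡ 0 →
  Dumont132 l (unshift (double t) L)
Dumont132-unshift t {L = L} perm dum avoids =
  PermOn-unshift (double t) perm ,
  trans (sym (dumontᵇ-shift-double t (unshift (double t) L))) (trans (cong dumontᵇ shift∘unshift) dum) ,
  trans (sym (count132-shift (double t) (unshift (double t) L))) (trans (cong count132 shift∘unshift) avoids)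
  where
  shift∘unshift = shift-unshift (double t) L (All.map proj₁ (proj₂ (proj₂ perm)))

leftBlock-form : ∀ m j l {L} → PermOn j (suc l) L → j + suc l ≡ suc (double m) →
  dumontᵇ L ≡ true → count132 L ≡ 0 →
  ∃[ i ] ∃[ σ ] i ≤ m × Dumont132 (double i) σ × j ≡ double (m ∸ i) × L ≡ shift (double (m ∸ i)) σ ++ [ suc (double m) ]
leftBlock-form m j l {L} perm len dum avoids with PermOn-dumont-offset-even j l perm dum
... | t , refl = m ∸ t , σ , m∸n≤m m t , proj₁ (proj₂ odd) , cong double (sym m∸[m∸t]≡t) , L≡
  where
  t≤m : t ≤ m
  t≤m = double-cancel-≤ (≤-pred (≤-trans (≤-reflexive (+-comm 1 (double t)))
                                          (≤-trans (+-monoʳ-≤ (double t) (s≤s z≤n)) (≤-reflexive len))))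
  m∸[m∸t]≡t : m ∸ (m ∸ t) ≡ t
  m∸[m∸t]≡t = m∸[m∸n]≡n t≤m
  length≡ : suc l ≡ suc (double (m ∸ t))
  length≡ = begin
    suc l                         ≡⟨ sym (m+n∸m≡n (double t) (suc l)) ⟩
    (double t + suc l) ∸ double t ≡⟨ cong (_∸ double t) len ⟩
    suc (double m) ∸ double t     ≡⟨ suc-double-∸ m t (≤-trans (m≤m+n (double t) (suc l)) (≤-reflexive len)) ⟩
    suc (double (m ∸ t))          ∎
    where open ≡-Reasoning
  shift∘unshift : shift (double t) (unshift (double t) L) ≡ L
  shift∘unshift = shift-unshift (double t) L (All.map proj₁ (proj₂ (proj₂ perm)))
  odd = Dumont132-odd-form (m ∸ t) (unshift (double t) L) (Dumont132-unshift t (PermOn-≡length length≡ perm) dum avoids)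
  σ = proj₁ odd
  top≡ : double t + suc (double (m ∸ t)) ≡ suc (double m)
  top≡ = trans (+-suc (double t) (double (m ∸ t))) (cong suc (trans (double-+ t (m ∸ t)) (cong double (m+[n∸m]≡n t≤m))))
  L≡ : L ≡ shift (double (m ∸ (m ∸ t))) σ ++ [ suc (double m) ]
  L≡ = begin
    L                                                    ≡⟨ sym shift∘unshift ⟩
    shift (double t) (unshift (double t) L)              ≡⟨ cong (shift (double t)) (proj₂ (proj₂ odd)) ⟩
    shift (double t) (σ ++ [ suc (double (m ∸ t)) ])     ≡⟨ map-++ (double t +_) σ _ ⟩
    shift (double t) σ ++ [ double t + suc (double (m ∸ t)) ]
      ≡⟨ cong₂ (λ a b → shift (double a) σ ++ [ b ]) (sym m∸[m∸t]≡t) top≡ ⟩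
    shift (double (m ∸ (m ∸ t))) σ ++ [ suc (double m) ] ∎
    where open ≡-Reasoning

Dumont132-even-form : ∀ m w → Dumont132 (suc (suc (double m))) w →
  (∃[ τ ] Dumont132 (double m) τ × w ≡ formA m τ) ⊎
  (∃[ i ] ∃[ σ ] ∃[ ρ ] i ≤ m × Dumont132 (double i) σ × Dumont132 (double (m ∸ i)) ρ × ρ ≢ [] × w ≡ formB m i σ ρ)
Dumont132-even-form m w w-D with splitAtMax (suc (double m)) w w-D
... | record { R = [] ; max∷R-dumont = dum } rewrite evenᵇ-double (suc m) with dum
... | ()
Dumont132-even-form m w w-D | record { L = L ; R = r ∷ R ; w≡ = w≡ ; L-perm = L-perm ; R-perm = R-perm ; length-L+R = len
                                     ; L-dumont = L-dum ; max∷R-dumont = dum ; L-avoids = L-avoids ; R-avoids = R-avoids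
                                     ; R<max = r<max ∷ _ } = byLeft L w≡ L-perm len L-dum L-avoids
  where
  ρ = r ∷ R
  ρ-dum : dumontᵇ ρ ≡ true
  ρ-dum = trans (sym (cong (_∧ dumontᵇ ρ) (evenᵇ-double (suc m))))
                (trans (sym (dumontᵇ-descent (suc (suc (double m))) r R r<max)) dum)
  byLeft : ∀ L → w ≡ L ++ suc (suc (double m)) ∷ ρ → PermOn (length ρ) (length L) L →
    length L + length ρ ≡ suc (double m) → dumontᵇ L ≡ true → count132 L ≡ 0 →
    (∃[ τ ] Dumont132 (double m) τ × w ≡ formA m τ) ⊎
    (∃[ i ] ∃[ σ ] ∃[ ρ ] i ≤ m × Dumont132 (double i) σ × Dumont132 (double (m ∸ i)) ρ × ρ ≢ [] × w ≡ formB m i σ ρ)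
  byLeft [] w≡ _ len _ _ with Dumont132-odd-form m ρ (PermOn-≡length len R-perm , ρ-dum , R-avoids)
  ... | τ , τ-D , ρ≡ = inj₁ (τ , τ-D , trans w≡ (cong (suc (suc (double m)) ∷_) ρ≡))
  byLeft (l ∷ L) w≡ L-perm len L-dum L-avoids
    with leftBlock-form m (length ρ) (length L) L-perm (trans (+-comm (length ρ) _) len) L-dum L-avoids
  ... | i , σ , i≤m , σ-D , |ρ|≡ , L≡ =
    inj₂ (i , σ , ρ , i≤m , σ-D , (PermOn-≡length |ρ|≡ R-perm , ρ-dum , R-avoids) , (λ ()) ,
          trans w≡ (trans (cong (_++ suc (suc (double m)) ∷ ρ) L≡) (++-assoc (shift (double (m ∸ i)) σ) [ suc (double m) ] _)))

-- Enumerating by the decomposition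

dumont132⁺ : ℕ → List (List ℕ)
dumont132⁺ zero    = []
dumont132⁺ (suc n) = dumont132 (suc n)

∈-dumont132⁺⁻ : ∀ n {ρ} → ρ ∈ dumont132⁺ n → ρ ∈ dumont132 n × ρ ≢ []
∈-dumont132⁺⁻ (suc n) ρ∈ = ρ∈ , λ { refl → 0≢1+n (∈-dumont132-length (suc n) ρ∈) }

∈-dumont132⁺⁺ : ∀ n {ρ} → ρ ∈ dumont132 n → ρ ≢ [] → ρ ∈ dumont132⁺ n
∈-dumont132⁺⁺ zero    (here refl) ρ≢[] = ⊥-elim (ρ≢[] refl)
∈-dumont132⁺⁺ (suc n) ρ∈          _    = ρ∈

dumont132⁺-unique : ∀ n → Unique (dumont132⁺ n)
dumont132⁺-unique zero    = []
dumont132⁺-unique (suc n) = dumont132-unique (suc n)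

concatUpTo : ℕ → (ℕ → List A₁) → List A₁
concatUpTo zero    f = f 0
concatUpTo (suc n) f = concatUpTo n f ++ f (suc n)

∈-concatUpTo⁻ : ∀ n (f : ℕ → List A₁) {w} → w ∈ concatUpTo n f → ∃[ i ] i ≤ n × w ∈ f i
∈-concatUpTo⁻ zero    f w∈ = 0 , z≤n , w∈
∈-concatUpTo⁻ (suc n) f w∈ with ∈-++⁻ (concatUpTo n f) w∈
... | inj₁ w∈₁ = let (i , i≤n , w∈fi) = ∈-concatUpTo⁻ n f w∈₁ in i , m≤n⇒m≤1+n i≤n , w∈fi
... | inj₂ w∈₂ = suc n , ≤-refl , w∈₂

∈-concatUpTo⁺ : ∀ n (f : ℕ → List A₁) {i w} → i ≤ n → w ∈ f i → w ∈ concatUpTo n f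
∈-concatUpTo⁺ zero    f z≤n w∈ = w∈
∈-concatUpTo⁺ (suc n) f i≤ w∈ with m≤n⇒m<n∨m≡n i≤
... | inj₁ i<1+n = ∈-++⁺ˡ (∈-concatUpTo⁺ n f (≤-pred i<1+n) w∈)
... | inj₂ refl  = ∈-++⁺ʳ (concatUpTo n f) w∈

countᵇ-concatUpTo : ∀ (p : A₁ → Bool) n (f : ℕ → List A₁) → countᵇ p (concatUpTo n f) ≡ sumTo n (countᵇ p ∘ f)
countᵇ-concatUpTo p zero    f = refl
countᵇ-concatUpTo p (suc n) f =
  trans (countᵇ-++ p (concatUpTo n f) (f (suc n))) (cong (_+ countᵇ p (f (suc n))) (countᵇ-concatUpTo p n f))

concatUpTo-unique : ∀ n (f : ℕ → List A₁) → (∀ i → i ≤ n → Unique (f i)) →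
  (∀ {i i′ w} → i ≤ n → i′ ≤ n → w ∈ f i → w ∈ f i′ → i ≡ i′) → Unique (concatUpTo n f)
concatUpTo-unique zero    f f! _     = f! 0 z≤n
concatUpTo-unique (suc n) f f! apart =
  Unique.++⁺ (concatUpTo-unique n f (λ i i≤n → f! i (m≤n⇒m≤1+n i≤n)) (λ i≤ i′≤ → apart (m≤n⇒m≤1+n i≤) (m≤n⇒m≤1+n i′≤)))
             (f! (suc n) ≤-refl)
             (λ (w∈₁ , w∈₂) → let (i , i≤n , w∈fi) = ∈-concatUpTo⁻ n f w∈₁ in
                <⇒≢ (s≤s i≤n) (apart (m≤n⇒m≤1+n i≤n) ≤-refl w∈fi w∈₂))

++-∷-split-unique : ∀ c (X Y X′ Y′ : List ℕ) → c ∉ X → c ∉ X′ → X ++ c ∷ Y ≡ X′ ++ c ∷ Y′ → X ≡ X′ × Y ≡ Y′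
++-∷-split-unique c []      Y []        Y′ _  _  eq = refl , ∷-injectiveʳ eq
++-∷-split-unique c []      Y (x′ ∷ X′) Y′ _  c∉ eq = ⊥-elim (c∉ (here (∷-injectiveˡ eq)))
++-∷-split-unique c (x ∷ X) Y []        Y′ c∉ _  eq = ⊥-elim (c∉ (here (sym (∷-injectiveˡ eq))))
++-∷-split-unique c (x ∷ X) Y (x′ ∷ X′) Y′ c∉ c∉′ eq =
  let (X≡ , Y≡) = ++-∷-split-unique c X Y X′ Y′ (c∉ ∘ there) (c∉′ ∘ there) (∷-injectiveʳ eq)
  in cong₂ _∷_ (∷-injectiveˡ eq) X≡ , Y≡

Unique-∉-prefix : ∀ c (X Y : List ℕ) → Unique (X ++ c ∷ Y) → c ∉ X
Unique-∉-prefix c X Y XcY! c∈ = proj₂ (proj₂ (Unique-++⁻ X (c ∷ Y) XcY!)) c∈ (here refl) refl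

formB-prefix : ℕ → ℕ → List ℕ → List ℕ
formB-prefix m i σ = shift (double (m ∸ i)) σ ++ [ suc (double m) ]

formB-split : ∀ m i σ ρ → formB m i σ ρ ≡ formB-prefix m i σ ++ suc (suc (double m)) ∷ ρ
formB-split m i σ ρ = sym (++-assoc (shift (double (m ∸ i)) σ) [ suc (double m) ] _)

-- Since the maximum occurs once, the prefix before it determines i and σ.
formB-injective : ∀ m {i i′ σ σ′ ρ ρ′} → length σ ≡ double i → length σ′ ≡ double i′ →
  Unique (formB m i σ ρ) → formB m i σ ρ ≡ formB m i′ σ′ ρ′ → i ≡ i′ × σ ≡ σ′ × ρ ≡ ρ′
formB-injective m {i} {i′} {σ} {σ′} {ρ} {ρ′} |σ| |σ′| w! eq with
  ++-∷-split-unique (suc (suc (double m))) (formB-prefix m i σ) ρ (formB-prefix m i′ σ′) ρ′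
    (Unique-∉-prefix _ _ ρ (subst Unique (formB-split m i σ ρ) w!))
    (Unique-∉-prefix _ _ ρ′ (subst Unique (trans eq (formB-split m i′ σ′ ρ′)) w!))
    (trans (sym (formB-split m i σ ρ)) (trans eq (formB-split m i′ σ′ ρ′)))
... | prefix≡ , ρ≡ρ′ with double-injective (+-cancelʳ-≡ 1 _ _ (trans (sym (prefix-length i σ |σ|))
                                                                      (trans (cong length prefix≡) (prefix-length i′ σ′ |σ′|))))
  where
  prefix-length : ∀ i σ → length σ ≡ double i → length (formB-prefix m i σ) ≡ double i + 1
  prefix-length i σ |σ| = trans (length-++ (shift (double (m ∸ i)) σ)) (cong (_+ 1) (trans (length-map _ σ) |σ|))
... | refl = refl , shift-injective (double (m ∸ i)) (∷ʳ-injectiveˡ _ _ prefix≡) , ρ≡ρ′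

oddForms : ℕ → List (List ℕ)
oddForms m = map (formO m) (dumont132 (double m))

formsB : ℕ → ℕ → List (List ℕ)
formsB m i = cartesianProductWith (formB m i) (dumont132 (double i)) (dumont132⁺ (double (m ∸ i)))

evenForms : ℕ → List (List ℕ)
evenForms m = map (formA m) (dumont132 (double m)) ++ concatUpTo m (formsB m)

oddForms⊆ : ∀ m {w} → w ∈ oddForms m → w ∈ dumont132 (suc (double m))
oddForms⊆ m w∈ with ∈-map⁻ (formO m) w∈
... | σ , σ∈ , refl = ∈-dumont132⁺ (suc (double m)) (formO-Dumont132 m (∈-dumont132⁻ (double m) σ∈))

⊆oddForms : ∀ m {w} → w ∈ dumont132 (suc (double m)) → w ∈ oddForms m
⊆oddForms m {w} w∈ with Dumont132-odd-form m w (∈-dumont132⁻ (suc (double m)) w∈)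
... | σ , σ-D , refl = ∈-map⁺ (formO m) (∈-dumont132⁺ (double m) σ-D)

oddForms-unique : ∀ m → Unique (oddForms m)
oddForms-unique m = Unique.map⁺ (∷ʳ-injectiveˡ _ _) (dumont132-unique (double m))

∈-formsB⁻ : ∀ m i {w} → i ≤ m → w ∈ formsB m i →
  ∃[ σ ] ∃[ ρ ] σ ∈ dumont132 (double i) × Dumont132 (suc (suc (double m))) w × w ≡ formB m i σ ρ
∈-formsB⁻ m i i≤m w∈ with ∈-cartesianProductWith⁻ (formB m i) (dumont132 (double i)) (dumont132⁺ (double (m ∸ i))) w∈
... | σ , ρ , σ∈ , ρ∈ , refl with ∈-dumont132⁺⁻ (double (m ∸ i)) ρ∈
... | ρ∈′ , ρ≢[] =
  σ , ρ , σ∈ , formB-Dumont132 m i i≤m (∈-dumont132⁻ (double i) σ∈) (∈-dumont132⁻ (double (m ∸ i)) ρ∈′) ρ≢[] , refl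

formsB-unique : ∀ m i → i ≤ m → Unique (formsB m i)
formsB-unique m i i≤m =
  Unique-cartesianProductWith-injectiveOn (formB m i) (dumont132 (double i)) (dumont132⁺ (double (m ∸ i)))
    (dumont132-unique (double i)) (dumont132⁺-unique (double (m ∸ i))) injective
  where
  injective : ∀ {σ σ′ ρ ρ′} → σ ∈ dumont132 (double i) → σ′ ∈ dumont132 (double i) → ρ ∈ dumont132⁺ (double (m ∸ i)) →
    ρ′ ∈ dumont132⁺ (double (m ∸ i)) → formB m i σ ρ ≡ formB m i σ′ ρ′ → σ ≡ σ′ × ρ ≡ ρ′
  injective σ∈ σ′∈ ρ∈ _ eq with ∈-formsB⁻ m i i≤m (∈-cartesianProductWith⁺ (formB m i) σ∈ ρ∈)
  ... | _ , _ , _ , ((_ , w! , _) , _) , _ =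
    proj₂ (formB-injective m (∈-dumont132-length (double i) σ∈) (∈-dumont132-length (double i) σ′∈) w! eq)

formsB-apart : ∀ m {i i′ w} → i ≤ m → i′ ≤ m → w ∈ formsB m i → w ∈ formsB m i′ → i ≡ i′
formsB-apart m i≤m i′≤m w∈ w∈′ with ∈-formsB⁻ m _ i≤m w∈ | ∈-formsB⁻ m _ i′≤m w∈′
... | σ , ρ , σ∈ , ((_ , w! , _) , _) , refl | σ′ , ρ′ , σ′∈ , _ , w≡ =
  proj₁ (formB-injective m (∈-dumont132-length _ σ∈) (∈-dumont132-length _ σ′∈) w! w≡)

formsB⊆ : ∀ m i {w} → i ≤ m → w ∈ formsB m i → w ∈ dumont132 (suc (suc (double m)))
formsB⊆ m i i≤m w∈ = let (_ , _ , _ , w-D , _) = ∈-formsB⁻ m i i≤m w∈ in ∈-dumont132⁺ _ w-D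

evenForms⊆ : ∀ m {w} → w ∈ evenForms m → w ∈ dumont132 (suc (suc (double m)))
evenForms⊆ m w∈ with ∈-++⁻ (map (formA m) (dumont132 (double m))) w∈
... | inj₁ w∈A with ∈-map⁻ (formA m) w∈A
...   | τ , τ∈ , refl = ∈-dumont132⁺ (suc (suc (double m))) (formA-Dumont132 m (∈-dumont132⁻ (double m) τ∈))
evenForms⊆ m w∈ | inj₂ w∈B with ∈-concatUpTo⁻ m (formsB m) w∈B
...   | i , i≤m , w∈Bi = formsB⊆ m i i≤m w∈Bi

⊆evenForms : ∀ m {w} → w ∈ dumont132 (suc (suc (double m))) → w ∈ evenForms m
⊆evenForms m {w} w∈ with Dumont132-even-form m w (∈-dumont132⁻ (suc (suc (double m))) w∈)
... | inj₁ (τ , τ-D , refl) = ∈-++⁺ˡ (∈-map⁺ (formA m) (∈-dumont132⁺ (double m) τ-D))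
... | inj₂ (i , σ , ρ , i≤m , σ-D , ρ-D , ρ≢[] , refl) =
  ∈-++⁺ʳ (map (formA m) (dumont132 (double m)))
         (∈-concatUpTo⁺ m (formsB m) i≤m
           (∈-cartesianProductWith⁺ (formB m i) (∈-dumont132⁺ (double i) σ-D)
                                    (∈-dumont132⁺⁺ (double (m ∸ i)) (∈-dumont132⁺ (double (m ∸ i)) ρ-D) ρ≢[])))

-- In formA the maximum comes first, in formB it does not.
formA-formsB-disjoint : ∀ m {w} → ¬ (w ∈ map (formA m) (dumont132 (double m)) × w ∈ concatUpTo m (formsB m))
formA-formsB-disjoint m (w∈A , w∈B) with ∈-map⁻ (formA m) w∈A | ∈-concatUpTo⁻ m (formsB m) w∈B
... | τ , _ , refl | i , i≤m , w∈Bi with ∈-formsB⁻ m i i≤m w∈Bi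
... | σ , ρ , _ , ((_ , w! , _) , _) , w≡ =
  ++-∷-≢[] (shift (double (m ∸ i)) σ) _ [] (sym (proj₁
    (++-∷-split-unique (suc (suc (double m))) [] (formO m τ) (formB-prefix m i σ) ρ (λ ())
      (Unique-∉-prefix _ _ ρ (subst Unique (trans w≡ (formB-split m i σ ρ)) w!))
      (trans w≡ (formB-split m i σ ρ)))))

evenForms-unique : ∀ m → Unique (evenForms m)
evenForms-unique m =
  Unique.++⁺ (Unique.map⁺ (∷ʳ-injectiveˡ _ _ ∘ ∷-injectiveʳ) (dumont132-unique (double m)))
             (concatUpTo-unique m (formsB m) (formsB-unique m) (formsB-apart m))
             (formA-formsB-disjoint m)

countᵇ-dumont132-odd : ∀ (p : List ℕ → Bool) m →
  countᵇ p (dumont132 (suc (double m))) ≡ countᵇ (p ∘ formO m) (dumont132 (double m))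
countᵇ-dumont132-odd p m =
  trans (countᵇ-sameElements (dumont132-unique (suc (double m))) (oddForms-unique m) (⊆oddForms m) (oddForms⊆ m) p)
        (countᵇ-map p (formO m) (dumont132 (double m)))

countᵇ-dumont132-even : ∀ (p : List ℕ → Bool) m →
  countᵇ p (dumont132 (suc (suc (double m)))) ≡
  countᵇ (p ∘ formA m) (dumont132 (double m)) +
  sumTo m (λ i → sum (map (λ σ → countᵇ (p ∘ formB m i σ) (dumont132⁺ (double (m ∸ i)))) (dumont132 (double i))))
countᵇ-dumont132-even p m = begin
  countᵇ p (dumont132 (suc (suc (double m))))
    ≡⟨ countᵇ-sameElements (dumont132-unique (suc (suc (double m)))) (evenForms-unique m) (⊆evenForms m) (evenForms⊆ m) p ⟩
  countᵇ p (evenForms m)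
    ≡⟨ countᵇ-++ p (map (formA m) (dumont132 (double m))) _ ⟩
  countᵇ p (map (formA m) (dumont132 (double m))) + countᵇ p (concatUpTo m (formsB m))
    ≡⟨ cong₂ _+_ (countᵇ-map p (formA m) (dumont132 (double m))) (countᵇ-concatUpTo p m (formsB m)) ⟩
  countᵇ (p ∘ formA m) (dumont132 (double m)) + sumTo m (countᵇ p ∘ formsB m)
    ≡⟨ cong (countᵇ (p ∘ formA m) (dumont132 (double m)) +_)
            (sumTo-ext m (λ i → countᵇ-cartesianProductWith p (formB m i) (dumont132 (double i)) (dumont132⁺ (double (m ∸ i))))) ⟩
  countᵇ (p ∘ formA m) (dumont132 (double m)) +
  sumTo m (λ i → sum (map (λ σ → countᵇ (p ∘ formB m i σ) (dumont132⁺ (double (m ∸ i)))) (dumont132 (double i)))) ∎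
  where open ≡-Reasoning

-- Counting occurrences of 12…k through the decomposition

≡ᵇ0-absorbˡ : ∀ a b → (0 < a → 0 < b) → (a + b ≡ᵇ 0) ≡ (b ≡ᵇ 0)
≡ᵇ0-absorbˡ zero    b       _     = refl
≡ᵇ0-absorbˡ (suc a) zero    a⇒b   = contradiction (a⇒b (s≤s z≤n)) λ ()
≡ᵇ0-absorbˡ (suc a) (suc b) _     = refl

≡ᵇ1-absorbˡ : ∀ a b → (0 < a → 2 ≤ b) → (a + b ≡ᵇ 1) ≡ (b ≡ᵇ 1)
≡ᵇ1-absorbˡ zero    b             _   = refl
≡ᵇ1-absorbˡ (suc a) zero          a⇒b = contradiction (a⇒b (s≤s z≤n)) λ ()
≡ᵇ1-absorbˡ (suc a) (suc zero)    a⇒b = contradiction (a⇒b (s≤s z≤n)) λ { (s≤s ()) }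
≡ᵇ1-absorbˡ (suc a) (suc (suc b)) _   rewrite +-suc a (suc b) = refl

∧-≡ᵇ1-absorbˡ : ∀ a b → (0 < a → 2 ≤ b) → ((a ≡ᵇ 0) ∧ (b ≡ᵇ 1)) ≡ (b ≡ᵇ 1)
∧-≡ᵇ1-absorbˡ zero    b             _   = refl
∧-≡ᵇ1-absorbˡ (suc a) zero          a⇒b = contradiction (a⇒b (s≤s z≤n)) λ ()
∧-≡ᵇ1-absorbˡ (suc a) (suc zero)    a⇒b = contradiction (a⇒b (s≤s z≤n)) λ { (s≤s ()) }
∧-≡ᵇ1-absorbˡ (suc a) (suc (suc b)) _   = refl

chain-≡ᵇ0 : ∀ a b c d → (0 < a → 0 < b) → (0 < b → 0 < c) →
  ((a + b) + (b + c) + d ≡ᵇ 0) ≡ (c ≡ᵇ 0) ∧ (d ≡ᵇ 0)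
chain-≡ᵇ0 a       b       (suc c) d _   _   =
  ≢⇒≡ᵇ-false (λ sum≡0 → 0≢1+n (sym (trans (sym (+-suc b c)) (m+n≡0⇒n≡0 (a + b) (m+n≡0⇒m≡0 _ sum≡0)))))
chain-≡ᵇ0 a       (suc b) zero    d _   b⇒c = contradiction (b⇒c (s≤s z≤n)) λ ()
chain-≡ᵇ0 (suc a) zero    zero    d a⇒b _   = contradiction (a⇒b (s≤s z≤n)) λ ()
chain-≡ᵇ0 zero    zero    zero    d _   _   = refl

chain-≡ᵇ1 : ∀ a b c d → (0 < a → 0 < b) → (0 < b → 0 < c) →
  ((a + b) + (b + c) + d ≡ᵇ 1) ≡ ((c ≡ᵇ 0) ∧ (d ≡ᵇ 1)) ∨ (((b ≡ᵇ 0) ∧ (c ≡ᵇ 1)) ∧ (d ≡ᵇ 0))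
chain-≡ᵇ1 a       (suc b) zero          d _   b⇒c = contradiction (b⇒c (s≤s z≤n)) λ ()
chain-≡ᵇ1 a       (suc b) (suc c)       d _   _   =
  ≢⇒≡ᵇ-false (λ sum≡1 → <-irrefl refl (≤-trans sum≥2 (≤-reflexive sum≡1)))
  where
  sum≥2 : 2 ≤ (a + suc b) + (suc b + suc c) + d
  sum≥2 = ≤-trans (+-mono-≤ (s≤s (z≤n {b})) (s≤s (z≤n {b})))
                  (≤-trans (+-mono-≤ (m≤n+m (suc b) a) (m≤m+n (suc b) (suc c))) (m≤m+n _ d))
chain-≡ᵇ1 (suc a) zero    c             d a⇒b _   = contradiction (a⇒b (s≤s z≤n)) λ ()
chain-≡ᵇ1 zero    zero    zero          d _   _   = sym (∨-identityʳ (d ≡ᵇ 1))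
chain-≡ᵇ1 zero    zero    (suc zero)    d _   _   = refl
chain-≡ᵇ1 zero    zero    (suc (suc c)) d _   _   = refl

countᵇ-∨-exclusive : ∀ (α γ : Bool) (B C : A₁ → Bool) xs → (∀ x → B x ∧ C x ≡ false) →
  countᵇ (λ x → (α ∧ B x) ∨ (γ ∧ C x)) xs ≡ (if α then countᵇ B xs else 0) + (if γ then countᵇ C xs else 0)
countᵇ-∨-exclusive true  true  B C []       _    = refl
countᵇ-∨-exclusive true  true  B C (x ∷ xs) excl with B x | C x | excl x
... | true  | true  | ()
... | true  | false | _ = cong suc (countᵇ-∨-exclusive true true B C xs excl)
... | false | true  | _ = trans (cong suc (countᵇ-∨-exclusive true true B C xs excl)) (sym (+-suc _ _))
... | false | false | _ = countᵇ-∨-exclusive true true B C xs excl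
countᵇ-∨-exclusive true  false B C xs _ = trans (countᵇ-ext xs (λ x → ∨-identityʳ (B x))) (sym (+-identityʳ _))
countᵇ-∨-exclusive false true  B C xs _ = refl
countᵇ-∨-exclusive false false B C xs _ = countᵇ-none _ xs (λ _ → refl)

avoid : ℕ → Series
avoid k m = countᵇ (λ w → inc k w ≡ᵇ 0) (dumont132 (double m))

avoid⁺ : ℕ → Series
avoid⁺ k m = countᵇ (λ w → inc k w ≡ᵇ 0) (dumont132⁺ (double m))

once : ℕ → Series
once k m = countᵇ (λ w → inc k w ≡ᵇ 1) (dumont132 (double m))

once⁺ : ℕ → Series
once⁺ k m = countᵇ (λ w → inc k w ≡ᵇ 1) (dumont132⁺ (double m))

avoidOnce : ℕ → Series
avoidOnce κ m = countᵇ (λ w → (inc (suc κ) w ≡ᵇ 0) ∧ (inc κ w ≡ᵇ 1)) (dumont132 (double m))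

inc-formO : ∀ κ m {σ} → Dumont132 (double m) σ → inc (suc (suc κ)) (formO m σ) ≡ inc (suc (suc κ)) σ + inc (suc κ) σ
inc-formO κ m (perm , _) = inc-∷ʳ-max (suc κ) _ (suc (double m)) (PermOn-< perm)

inc-formA : ∀ κ m {τ} → Dumont132 (double m) τ → inc (suc (suc κ)) (formA m τ) ≡ inc (suc (suc κ)) τ + inc (suc κ) τ
inc-formA κ m {τ} τ-D =
  trans (inc-∷-max κ (suc (suc (double m))) (formO m τ) (PermOn-< (proj₁ (formO-Dumont132 m τ-D)))) (inc-formO κ m τ-D)

inc-formB : ∀ κ m i {σ ρ} → i ≤ m → Dumont132 (double i) σ → Dumont132 (double (m ∸ i)) ρ →
  inc (suc (suc κ)) (formB m i σ ρ) ≡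
  (inc (suc (suc κ)) σ + inc (suc κ) σ) + (inc (suc κ) σ + inc κ σ) + inc (suc (suc κ)) ρ
inc-formB κ m i {σ} {ρ} i≤m (σ-perm , _) (ρ-perm , _) = begin
  inc k (formB m i σ ρ)
    ≡⟨ cong (inc k) (formB-assoc m i σ ρ) ⟩
  inc k (Y ++ ρ)
    ≡⟨ inc-++-separated (suc κ) Y ρ ρ<Y ⟩
  inc k Y + inc k ρ
    ≡⟨ cong (λ z → inc k z + inc k ρ) (sym (++-assoc S [ suc (double m) ] [ suc (suc (double m)) ])) ⟩
  inc k ((S ++ [ suc (double m) ]) ++ [ suc (suc (double m)) ]) + inc k ρ
    ≡⟨ cong (_+ inc k ρ) (inc-∷ʳ-max (suc κ) (S ++ [ suc (double m) ]) (suc (suc (double m)))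
                                      (++⁺ (All.map (λ v< → <-trans v< (n<1+n _)) S<2m+1) (n<1+n _ ∷ []))) ⟩
  inc k (S ++ [ suc (double m) ]) + inc (suc κ) (S ++ [ suc (double m) ]) + inc k ρ
    ≡⟨ cong (_+ inc k ρ) (cong₂ _+_ (inc-∷ʳ-max (suc κ) S (suc (double m)) S<2m+1) (inc-∷ʳ-max κ S (suc (double m)) S<2m+1)) ⟩
  (inc k S + inc (suc κ) S) + (inc (suc κ) S + inc κ S) + inc k ρ
    ≡⟨ cong (_+ inc k ρ) (cong₂ _+_ (cong₂ _+_ (inc-shift k j σ) (inc-shift (suc κ) j σ))
                                    (cong₂ _+_ (inc-shift (suc κ) j σ) (inc-shift κ j σ))) ⟩
  (inc k σ + inc (suc κ) σ) + (inc (suc κ) σ + inc κ σ) + inc k ρ ∎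
  where
  open ≡-Reasoning
  k = suc (suc κ)
  j = double (m ∸ i)
  j+2i≡2m : j + double i ≡ double m
  j+2i≡2m = trans (double-+ (m ∸ i) i) (cong double (m∸n+n≡m i≤m))
  S = shift j σ
  Y = S ++ suc (double m) ∷ [ suc (suc (double m)) ]
  S∈ : All (Within j (j + double i)) S
  S∈ = proj₂ (proj₂ (subst (λ a → PermOn a (double i) S) (+-identityʳ j) (PermOn-shift j σ-perm)))
  S<2m+1 : All (_< suc (double m)) S
  S<2m+1 = All.map (λ (_ , v≤) → s≤s (≤-trans v≤ (≤-reflexive j+2i≡2m))) S∈
  j<Y : All (j <_) Y
  j<Y = ++⁺ (All.map proj₁ S∈)
            (s≤s (≤-trans (m≤m+n j (double i)) (≤-reflexive j+2i≡2m))
             ∷ s≤s (≤-trans (m≤m+n j (double i)) (≤-trans (≤-reflexive j+2i≡2m) (n≤1+n _))) ∷ [])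
  ρ<Y : ∀ {y} → y ∈ Y → All (_< y) ρ
  ρ<Y y∈ = All.map (λ v≤j → ≤-<-trans v≤j (All.lookup j<Y y∈)) (All.map proj₂ (proj₂ (proj₂ ρ-perm)))

once-odd : ∀ κ m → countᵇ (λ w → inc (suc (suc κ)) w ≡ᵇ 1) (dumont132 (suc (double m))) ≡ once (suc κ) m
once-odd κ m = trans (countᵇ-dumont132-odd _ m) (countᵇ-cong (dumont132 (double m)) (λ {σ} σ∈ →
  trans (cong (_≡ᵇ 1) (inc-formO κ m (∈-dumont132⁻ (double m) σ∈))) (≡ᵇ1-absorbˡ _ _ (inc-pos⇒≥2 κ σ))))

module _ (κ m : ℕ) where
  private
    k = suc (suc κ)
    ρs : ℕ → List (List ℕ)
    ρs i = dumont132⁺ (double (m ∸ i))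
    inc-formB′ : ∀ {i σ ρ} → i ≤ m → σ ∈ dumont132 (double i) → ρ ∈ ρs i →
      inc k (formB m i σ ρ) ≡ (inc k σ + inc (suc κ) σ) + (inc (suc κ) σ + inc κ σ) + inc k ρ
    inc-formB′ {i} i≤m σ∈ ρ∈ =
      inc-formB κ m i i≤m (∈-dumont132⁻ (double i) σ∈) (∈-dumont132⁻ (double (m ∸ i)) (proj₁ (∈-dumont132⁺⁻ (double (m ∸ i)) ρ∈)))

  avoid-suc : avoid k (suc m) ≡ avoid (suc κ) m + (avoid κ ⊛ avoid⁺ k) m
  avoid-suc = trans (countᵇ-dumont132-even _ m) (cong₂ _+_ viaA (sumTo-cong m viaB))
    where
    viaA : countᵇ (λ τ → inc k (formA m τ) ≡ᵇ 0) (dumont132 (double m)) ≡ avoid (suc κ) m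
    viaA = countᵇ-cong (dumont132 (double m)) (λ {τ} τ∈ →
      trans (cong (_≡ᵇ 0) (inc-formA κ m (∈-dumont132⁻ (double m) τ∈))) (≡ᵇ0-absorbˡ _ _ (inc-pos-pred (suc κ) τ)))
    perσ : ∀ {i σ} → i ≤ m → σ ∈ dumont132 (double i) →
      countᵇ (λ ρ → inc k (formB m i σ ρ) ≡ᵇ 0) (ρs i) ≡ (if inc κ σ ≡ᵇ 0 then avoid⁺ k (m ∸ i) else 0)
    perσ {i} {σ} i≤m σ∈ =
      trans (countᵇ-cong {q = λ ρ → (inc κ σ ≡ᵇ 0) ∧ (inc k ρ ≡ᵇ 0)} (ρs i) (λ ρ∈ →
               trans (cong (_≡ᵇ 0) (inc-formB′ i≤m σ∈ ρ∈)) (chain-≡ᵇ0 _ _ _ _ (inc-pos-pred (suc κ) σ) (inc-pos-pred κ σ))))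
            (countᵇ-∧ˡ (inc κ σ ≡ᵇ 0) _ (ρs i))
    viaB : ∀ i → i ≤ m →
      sum (map (λ σ → countᵇ (λ ρ → inc k (formB m i σ ρ) ≡ᵇ 0) (ρs i)) (dumont132 (double i))) ≡ avoid κ i * avoid⁺ k (m ∸ i)
    viaB i i≤m = trans (cong sum (map-cong-local (All.tabulate (perσ i≤m))))
                       (sum-map-if (λ σ → inc κ σ ≡ᵇ 0) (avoid⁺ k (m ∸ i)) (dumont132 (double i)))

  once-suc : once k (suc m) ≡ once (suc κ) m + ((avoid κ ⊛ once⁺ k) m + (avoidOnce κ ⊛ avoid⁺ k) m)
  once-suc = trans (countᵇ-dumont132-even _ m) (cong₂ _+_ viaA (trans (sumTo-cong m viaB) (sumTo-+ m _ _)))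
    where
    viaA : countᵇ (λ τ → inc k (formA m τ) ≡ᵇ 1) (dumont132 (double m)) ≡ once (suc κ) m
    viaA = countᵇ-cong (dumont132 (double m)) (λ {τ} τ∈ →
      trans (cong (_≡ᵇ 1) (inc-formA κ m (∈-dumont132⁻ (double m) τ∈))) (≡ᵇ1-absorbˡ _ _ (inc-pos⇒≥2 κ τ)))
    exclusive : ∀ ρ → (inc k ρ ≡ᵇ 1) ∧ (inc k ρ ≡ᵇ 0) ≡ false
    exclusive ρ with inc k ρ
    ... | zero        = refl
    ... | suc zero    = refl
    ... | suc (suc _) = refl
    perσ : ∀ {i σ} → i ≤ m → σ ∈ dumont132 (double i) →
      countᵇ (λ ρ → inc k (formB m i σ ρ) ≡ᵇ 1) (ρs i) ≡
      (if inc κ σ ≡ᵇ 0 then once⁺ k (m ∸ i) else 0) + (if (inc (suc κ) σ ≡ᵇ 0) ∧ (inc κ σ ≡ᵇ 1) then avoid⁺ k (m ∸ i) else 0)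
    perσ {i} {σ} i≤m σ∈ =
      trans (countᵇ-cong {q = λ ρ → ((inc κ σ ≡ᵇ 0) ∧ (inc k ρ ≡ᵇ 1)) ∨ (((inc (suc κ) σ ≡ᵇ 0) ∧ (inc κ σ ≡ᵇ 1)) ∧ (inc k ρ ≡ᵇ 0))}
                         (ρs i) (λ ρ∈ →
               trans (cong (_≡ᵇ 1) (inc-formB′ i≤m σ∈ ρ∈)) (chain-≡ᵇ1 _ _ _ _ (inc-pos-pred (suc κ) σ) (inc-pos-pred κ σ))))
            (countᵇ-∨-exclusive (inc κ σ ≡ᵇ 0) ((inc (suc κ) σ ≡ᵇ 0) ∧ (inc κ σ ≡ᵇ 1))
                                (λ ρ → inc k ρ ≡ᵇ 1) (λ ρ → inc k ρ ≡ᵇ 0) (ρs i) exclusive)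
    viaB : ∀ i → i ≤ m →
      sum (map (λ σ → countᵇ (λ ρ → inc k (formB m i σ ρ) ≡ᵇ 1) (ρs i)) (dumont132 (double i))) ≡
      avoid κ i * once⁺ k (m ∸ i) + avoidOnce κ i * avoid⁺ k (m ∸ i)
    viaB i i≤m =
      trans (cong sum (map-cong-local (All.tabulate (perσ i≤m))))
            (trans (sum-map-+ _ _ (dumont132 (double i)))
                   (cong₂ _+_ (sum-map-if (λ σ → inc κ σ ≡ᵇ 0) (once⁺ k (m ∸ i)) (dumont132 (double i)))
                              (sum-map-if (λ σ → (inc (suc κ) σ ≡ᵇ 0) ∧ (inc κ σ ≡ᵇ 1)) (avoid⁺ k (m ∸ i)) (dumont132 (double i)))))

-- Generating functions

avoid⁺-fixedPoint : ∀ κ → avoid⁺ (suc (suc κ)) ≗ X ⊛ avoid (suc κ) ⊕ (X ⊛ avoid κ) ⊛ avoid⁺ (suc (suc κ))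
avoid⁺-fixedPoint κ zero    = refl
avoid⁺-fixedPoint κ (suc m) =
  trans (avoid-suc κ m) (sym (cong₂ _+_ (X⊛-suc (avoid (suc κ)) m) (X⊛⊛-suc (avoid κ) (avoid⁺ (suc (suc κ))) m)))

avoid⁺≗geom : ∀ κ → avoid⁺ (suc (suc κ)) ≗ geom (X ⊛ avoid κ) ⊛ (X ⊛ avoid (suc κ))
avoid⁺≗geom κ = fixedPoint≗geom⊛ (X ⊛ avoid (suc κ)) (X ⊛ avoid κ) refl (avoid⁺-fixedPoint κ)

avoid≗𝟙⊕avoid⁺ : ∀ k → avoid (suc k) ≗ 𝟙 ⊕ avoid⁺ (suc k)
avoid≗𝟙⊕avoid⁺ k zero    = refl
avoid≗𝟙⊕avoid⁺ k (suc m) = refl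

avoid-0 : avoid 0 ≗ 𝟘
avoid-0 m = countᵇ-none _ (dumont132 (double m)) (λ _ → refl)

avoid-1 : avoid 1 ≗ 𝟙
avoid-1 zero    = refl
avoid-1 (suc m) = countᵇ-none _ (dumont132 (double (suc m))) (λ {w} w∈ →
  cong (_≡ᵇ 0) (trans (inc1≡length w) (∈-dumont132-length (double (suc m)) w∈)))

avoid≗Φ : ∀ k → avoid k ≗ Φ k
avoid≗Φ zero          = avoid-0
avoid≗Φ (suc zero)    = avoid-1
avoid≗Φ (suc (suc κ)) = begin
  avoid (suc (suc κ))
    ≈⟨ avoid≗𝟙⊕avoid⁺ (suc κ) ⟩
  𝟙 ⊕ avoid⁺ (suc (suc κ))
    ≈⟨ ⊕-cong {𝟙} (λ _ → refl) (avoid⁺≗geom κ) ⟩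
  𝟙 ⊕ geom (X ⊛ avoid κ) ⊛ (X ⊛ avoid (suc κ))
    ≈⟨ ⊕-cong {𝟙} (λ _ → refl) (⊛-comm (geom (X ⊛ avoid κ)) (X ⊛ avoid (suc κ))) ⟩
  𝟙 ⊕ (X ⊛ avoid (suc κ)) ⊛ geom (X ⊛ avoid κ)
    ≈⟨ ⊕-cong {𝟙} (λ _ → refl) (⊛-cong (⊛-congʳ X (avoid≗Φ (suc κ))) (geom-cong (⊛-congʳ X (avoid≗Φ κ)))) ⟩
  Φ (suc (suc κ)) ∎
  where open ≗-Reasoning

once⁺≗once : ∀ k → once⁺ (suc k) ≗ once (suc k)
once⁺≗once k zero    = refl
once⁺≗once k (suc m) = refl

once-fixedPoint : ∀ κ → once (suc (suc κ)) ≗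
  (X ⊛ once (suc κ) ⊕ (X ⊛ avoidOnce κ) ⊛ avoid⁺ (suc (suc κ))) ⊕ (X ⊛ avoid κ) ⊛ once (suc (suc κ))
once-fixedPoint κ zero    = refl
once-fixedPoint κ (suc m) = begin
  once k (suc m)
    ≡⟨ once-suc κ m ⟩
  once (suc κ) m + ((avoid κ ⊛ once⁺ k) m + (avoidOnce κ ⊛ avoid⁺ k) m)
    ≡⟨ cong (λ z → once (suc κ) m + (z + (avoidOnce κ ⊛ avoid⁺ k) m)) (⊛-congʳ (avoid κ) (once⁺≗once (suc κ)) m) ⟩
  once (suc κ) m + ((avoid κ ⊛ once k) m + (avoidOnce κ ⊛ avoid⁺ k) m)
    ≡⟨ cong (once (suc κ) m +_) (+-comm ((avoid κ ⊛ once k) m) _) ⟩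
  once (suc κ) m + ((avoidOnce κ ⊛ avoid⁺ k) m + (avoid κ ⊛ once k) m)
    ≡⟨ sym (+-assoc (once (suc κ) m) _ _) ⟩
  once (suc κ) m + (avoidOnce κ ⊛ avoid⁺ k) m + (avoid κ ⊛ once k) m
    ≡⟨ sym (cong₂ _+_ (cong₂ _+_ (X⊛-suc (once (suc κ)) m) (X⊛⊛-suc (avoidOnce κ) (avoid⁺ k) m)) (X⊛⊛-suc (avoid κ) (once k) m)) ⟩
  ((X ⊛ once (suc κ) ⊕ (X ⊛ avoidOnce κ) ⊛ avoid⁺ k) ⊕ (X ⊛ avoid κ) ⊛ once k) (suc m) ∎
  where
  open ≡-Reasoning
  k = suc (suc κ)

once≗geom : ∀ κ → once (suc (suc κ)) ≗ geom (X ⊛ avoid κ) ⊛ (X ⊛ once (suc κ) ⊕ (X ⊛ avoidOnce κ) ⊛ avoid⁺ (suc (suc κ)))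
once≗geom κ = fixedPoint≗geom⊛ _ (X ⊛ avoid κ) refl (once-fixedPoint κ)

avoidOnce-0 : avoidOnce 0 ≗ 𝟙
avoidOnce-0 zero    = refl
avoidOnce-0 (suc m) = countᵇ-none _ (dumont132 (double (suc m))) (λ {w} w∈ →
  cong (λ z → (z ≡ᵇ 0) ∧ true) (trans (inc1≡length w) (∈-dumont132-length (double (suc m)) w∈)))

avoidOnce-suc : ∀ κ → avoidOnce (suc κ) ≗ once (suc κ)
avoidOnce-suc κ m = countᵇ-ext (dumont132 (double m)) (λ w → ∧-≡ᵇ1-absorbˡ _ _ (inc-pos⇒≥2 κ w))

once-1 : once 1 ≗ 𝟘
once-1 m = countᵇ-none _ (dumont132 (double m)) (λ {w} w∈ →
  trans (cong (_≡ᵇ 1) (trans (inc1≡length w) (∈-dumont132-length (double m) w∈))) (double≢1 m))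
  where
  double≢1 : ∀ n → (double n ≡ᵇ 1) ≡ false
  double≢1 zero    = refl
  double≢1 (suc n) = refl

once-2 : once 2 ≗ pow X 2
once-2 = begin
  once 2
    ≈⟨ once≗geom 0 ⟩
  geom (X ⊛ avoid 0) ⊛ (X ⊛ once 1 ⊕ (X ⊛ avoidOnce 0) ⊛ avoid⁺ 2)
    ≈⟨ ⊛-cong geom-X⊛avoid0≗𝟙 (⊕-cong (≗-trans (⊛-congʳ X once-1) (⊛-zeroʳ X))
                                       (⊛-cong (≗-trans (⊛-congʳ X avoidOnce-0) (⊛-identityʳ X)) avoid⁺2≗X⊛𝟙)) ⟩
  𝟙 ⊛ (𝟘 ⊕ X ⊛ (X ⊛ 𝟙))
    ≈⟨ ⊛-identityˡ _ ⟩
  pow X 2 ∎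
  where
  open ≗-Reasoning
  geom-X⊛avoid0≗𝟙 : geom (X ⊛ avoid 0) ≗ 𝟙
  geom-X⊛avoid0≗𝟙 = geom-𝟘 (≗-trans (⊛-congʳ X avoid-0) (⊛-zeroʳ X))
  avoid⁺2≗X⊛𝟙 : avoid⁺ 2 ≗ X ⊛ 𝟙
  avoid⁺2≗X⊛𝟙 = ≗-trans (avoid⁺≗geom 0)
                  (≗-trans (⊛-congˡ (X ⊛ avoid 1) geom-X⊛avoid0≗𝟙) (≗-trans (⊛-identityˡ _) (⊛-congʳ X avoid-1)))

-- Brings the solution of once's fixed-point equation into the shape of Ψ's recurrence.
geom-rearrange : ∀ g Ψ₂ Ψ₁ Φ₂ →
  g ⊛ (X ⊛ Ψ₂ ⊕ (X ⊛ Ψ₁) ⊛ (g ⊛ (X ⊛ Φ₂))) ≗ X ⊛ g ⊛ Ψ₂ ⊕ pow X 2 ⊛ Φ₂ ⊛ g ⊛ g ⊛ Ψ₁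
geom-rearrange g Ψ₂ Ψ₁ Φ₂ = ≗-trans (⊛-distribˡ g (X ⊛ Ψ₂) ((X ⊛ Ψ₁) ⊛ (g ⊛ (X ⊛ Φ₂)))) (⊕-cong first second)
  where
  open ≗-Reasoning
  first : g ⊛ (X ⊛ Ψ₂) ≗ X ⊛ g ⊛ Ψ₂
  first = ≗-trans (≗-sym (⊛-assoc g X Ψ₂)) (⊛-congˡ Ψ₂ (⊛-comm g X))
  second : g ⊛ ((X ⊛ Ψ₁) ⊛ (g ⊛ (X ⊛ Φ₂))) ≗ pow X 2 ⊛ Φ₂ ⊛ g ⊛ g ⊛ Ψ₁
  second = begin
    g ⊛ ((X ⊛ Ψ₁) ⊛ (g ⊛ (X ⊛ Φ₂)))   ≈⟨ ⊛-congʳ g (⊛-assoc X Ψ₁ (g ⊛ (X ⊛ Φ₂))) ⟩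
    g ⊛ (X ⊛ (Ψ₁ ⊛ (g ⊛ (X ⊛ Φ₂))))   ≈⟨ ⊛-leftComm g X (Ψ₁ ⊛ (g ⊛ (X ⊛ Φ₂))) ⟩
    X ⊛ (g ⊛ (Ψ₁ ⊛ (g ⊛ (X ⊛ Φ₂))))   ≈⟨ ⊛-congʳ X (⊛-congʳ g (⊛-leftComm Ψ₁ g (X ⊛ Φ₂))) ⟩
    X ⊛ (g ⊛ (g ⊛ (Ψ₁ ⊛ (X ⊛ Φ₂))))   ≈⟨ ⊛-congʳ X (⊛-congʳ g (⊛-congʳ g (⊛-leftComm Ψ₁ X Φ₂))) ⟩
    X ⊛ (g ⊛ (g ⊛ (X ⊛ (Ψ₁ ⊛ Φ₂))))   ≈⟨ ⊛-congʳ X (⊛-congʳ g (⊛-leftComm g X (Ψ₁ ⊛ Φ₂))) ⟩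
    X ⊛ (g ⊛ (X ⊛ (g ⊛ (Ψ₁ ⊛ Φ₂))))   ≈⟨ ⊛-congʳ X (⊛-leftComm g X (g ⊛ (Ψ₁ ⊛ Φ₂))) ⟩
    X ⊛ (X ⊛ (g ⊛ (g ⊛ (Ψ₁ ⊛ Φ₂))))   ≈⟨ ⊛-congʳ X (⊛-congʳ X (⊛-congʳ g (⊛-congʳ g (⊛-comm Ψ₁ Φ₂)))) ⟩
    X ⊛ (X ⊛ (g ⊛ (g ⊛ (Φ₂ ⊛ Ψ₁))))   ≈⟨ ⊛-congʳ X (⊛-congʳ X (⊛-congʳ g (⊛-leftComm g Φ₂ Ψ₁))) ⟩
    X ⊛ (X ⊛ (g ⊛ (Φ₂ ⊛ (g ⊛ Ψ₁))))   ≈⟨ ⊛-congʳ X (⊛-congʳ X (⊛-leftComm g Φ₂ (g ⊛ Ψ₁))) ⟩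
    X ⊛ (X ⊛ (Φ₂ ⊛ (g ⊛ (g ⊛ Ψ₁))))   ≈⟨ ≗-sym (⊛-assoc X X (Φ₂ ⊛ (g ⊛ (g ⊛ Ψ₁)))) ⟩
    (X ⊛ X) ⊛ (Φ₂ ⊛ (g ⊛ (g ⊛ Ψ₁)))   ≈⟨ ⊛-congˡ (Φ₂ ⊛ (g ⊛ (g ⊛ Ψ₁))) (⊛-congʳ X (≗-sym (⊛-identityʳ X))) ⟩
    pow X 2 ⊛ (Φ₂ ⊛ (g ⊛ (g ⊛ Ψ₁)))   ≈⟨ ≗-sym (⊛-assoc (pow X 2) Φ₂ (g ⊛ (g ⊛ Ψ₁))) ⟩
    pow X 2 ⊛ Φ₂ ⊛ (g ⊛ (g ⊛ Ψ₁))     ≈⟨ ≗-sym (⊛-assoc (pow X 2 ⊛ Φ₂) g (g ⊛ Ψ₁)) ⟩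
    pow X 2 ⊛ Φ₂ ⊛ g ⊛ (g ⊛ Ψ₁)       ≈⟨ ≗-sym (⊛-assoc (pow X 2 ⊛ Φ₂ ⊛ g) g Ψ₁) ⟩
    pow X 2 ⊛ Φ₂ ⊛ g ⊛ g ⊛ Ψ₁         ∎

once≗Ψ : ∀ κ → once (suc κ) ≗ Ψ (suc κ)
once≗Ψ zero          = once-1
once≗Ψ (suc zero)    = once-2
once≗Ψ (suc (suc κ)) = begin
  once (suc (suc (suc κ)))
    ≈⟨ once≗geom (suc κ) ⟩
  geom (X ⊛ avoid (suc κ)) ⊛ (X ⊛ once (suc (suc κ)) ⊕ (X ⊛ avoidOnce (suc κ)) ⊛ avoid⁺ (suc (suc (suc κ))))
    ≈⟨ ⊛-cong G (⊕-cong (⊛-congʳ X (once≗Ψ (suc κ)))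
                         (⊛-cong (⊛-congʳ X (≗-trans (avoidOnce-suc κ) (once≗Ψ κ)))
                                 (≗-trans (avoid⁺≗geom (suc κ)) (⊛-cong G (⊛-congʳ X (avoid≗Φ (suc (suc κ)))))))) ⟩
  geom (X ⊛ Φ (suc κ)) ⊛ (X ⊛ Ψ (suc (suc κ)) ⊕ (X ⊛ Ψ (suc κ)) ⊛ (geom (X ⊛ Φ (suc κ)) ⊛ (X ⊛ Φ (suc (suc κ)))))
    ≈⟨ geom-rearrange (geom (X ⊛ Φ (suc κ))) (Ψ (suc (suc κ))) (Ψ (suc κ)) (Φ (suc (suc κ))) ⟩
  Ψ (suc (suc (suc κ))) ∎
  where
  open ≗-Reasoning
  G : geom (X ⊛ avoid (suc κ)) ≗ geom (X ⊛ Φ (suc κ))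
  G = geom-cong (⊛-congʳ X (avoid≗Φ (suc κ)))

A-double : ∀ k m → A k (double m) ≡ Ψ k m
A-double k m = trans (A≗Ψ[x²] k (double m)) ([x²]-double (Ψ k) m)

A-odd : ∀ k m → A k (suc (double m)) ≡ 0
A-odd k m = trans (A≗Ψ[x²] k (suc (double m))) ([x²]-odd (Ψ k) m)

-- Even lengths contribute through A k, odd lengths 2m+1 (ending in their
-- maximum) through x A (k - 1).
countᵇ-once≡A⊕X⊛A : ∀ κ n →
  countᵇ (λ π → inc (suc (suc κ)) π ≡ᵇ 1) (dumont132 n) ≡ (A (suc (suc κ)) ⊕ X ⊛ A (suc κ)) n
countᵇ-once≡A⊕X⊛A κ n with parityView n
... | inj₁ (m , refl) = begin
  once (suc (suc κ)) m                               ≡⟨ once≗Ψ (suc κ) m ⟩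
  Ψ (suc (suc κ)) m                                  ≡⟨ sym (A-double (suc (suc κ)) m) ⟩
  A (suc (suc κ)) (double m)                         ≡⟨ sym (+-identityʳ _) ⟩
  A (suc (suc κ)) (double m) + 0                     ≡⟨ cong (A (suc (suc κ)) (double m) +_) (sym (X⊛A-even m)) ⟩
  A (suc (suc κ)) (double m) + (X ⊛ A (suc κ)) (double m) ∎
  where
  open ≡-Reasoning
  X⊛A-even : ∀ m → (X ⊛ A (suc κ)) (double m) ≡ 0
  X⊛A-even zero    = refl
  X⊛A-even (suc m) = trans (X⊛-suc (A (suc κ)) (suc (double m))) (A-odd (suc κ) m)
... | inj₂ (m , refl) = begin
  countᵇ (λ π → inc (suc (suc κ)) π ≡ᵇ 1) (dumont132 (suc (double m)))
    ≡⟨ once-odd κ m ⟩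
  once (suc κ) m
    ≡⟨ once≗Ψ κ m ⟩
  Ψ (suc κ) m
    ≡⟨ sym (A-double (suc κ) m) ⟩
  A (suc κ) (double m)
    ≡⟨ sym (X⊛-suc (A (suc κ)) (double m)) ⟩
  (X ⊛ A (suc κ)) (suc (double m))
    ≡⟨ cong (_+ (X ⊛ A (suc κ)) (suc (double m))) (sym (A-odd (suc (suc κ)) m)) ⟩
  A (suc (suc κ)) (suc (double m)) + (X ⊛ A (suc κ)) (suc (double m)) ∎
  where open ≡-Reasoning

theorem3p1 : (k : ℕ) → 2 ≤ k → (n : ℕ) →
    D (incPat k) 1 n ≡ (A k ⊕ X ⊛ A (k ∸ 1)) n
theorem3p1 (suc zero)      (s≤s ()) n
theorem3p1 k@(suc (suc κ)) _        n = begin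
  D (incPat k) 1 n
    ≡⟨ D≡countᵇ-dumont132 (incPat k) 1 n ⟩
  countᵇ (λ π → occ (incPat k) π ≡ᵇ 1) (dumont132 n)
    ≡⟨ countᵇ-ext (dumont132 n) (λ π → cong (_≡ᵇ 1) (occ-incPat k π)) ⟩
  countᵇ (λ π → inc k π ≡ᵇ 1) (dumont132 n)
    ≡⟨ countᵇ-once≡A⊕X⊛A κ n ⟩
  (A k ⊕ X ⊛ A (suc κ)) n ∎
  where open ≡-Reasoning
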